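{- For every tree $T$ on a finite set $I$, the lattice $[\hat 0,T]$ (an interval of $\operatorname{For}(I)$) is an LL-lattice.
   Context: A tree on a finite set $I$ is a rooted binary tree (not considered as planar) whose leaves are bijectively labeled by $I$: every vertex is either an inner vertex of valence 3, or a vertex of valence 1 (a leaf or the root); edges are oriented towards the root. A forest on $I$ is a set of trees on pairwise disjoint label sets whose union is $I$. For forests $F,G$ on $I$, $F\le G$ means there is a continuous map from $F$ to $G$ such that: (D1) it is increasing with respect to the orientation towards the root; (D2) it maps inner vertices to inner vertices injectively; (D3) it restricts to the identity of $I$ on leaves; (D4) its restriction to each tree of $F$ is injective. This is a partial order on the set $\operatorname{For}(I)$ of forests on $I$, graded by the number of inner vertices, with minimum $\hat 0$ the forest with no inner vertices; the interval $[\hat 0,T]$ is a lattice. In a finite lattice $L$, an element $x$ is left-modular if $y\vee(x\wedge z)=(y\vee x)\wedge z$ for all $y\le z$ in $L$; a maximal chain is left-modular if all its elements are. A maximal chain $m:\hat 0=x_0\lhd x_1\lhd\cdots\lhd x_n=\hat 1$ partitions the set $\mathsf A$ of atoms into levels $\mathsf A_i=\{a\in\mathsf A: a\le x_i,\ a\not\le x_{i-1}\}$, $i\in[n]$; write $a\lhd_m b$ if $a\in\mathsf A_i$, $b\in\mathsf A_j$ with $i<j$. The chain $m$ satisfies the level condition if whenever $a_0\lhd_m a_1\lhd_m\cdots\lhd_m a_k$ are atoms, $a_0\not\le a_1\vee\cdots\vee a_k$. An LL-lattice is a finite lattice having a maximal chain which is left-modular and satisfies the level condition. -}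

module Defs where

open import Data.Nat using (ℕ; zero; suc)
open import Data.Fin using (Fin; fromℕ; inject₁) renaming (_<_ to _<ᶠ_; zero to fzero; suc to fsuc)
open import Data.List using (List; []; _∷_; length; lookup; concatMap; map)
open import Data.List.Membership.Propositional using (_∈_)
open import Data.List.Relation.Unary.Unique.Propositional using (Unique)
open import Data.List.Relation.Unary.All using (All)
open import Data.List.Relation.Unary.Any using (Any)
open import Data.List.Relation.Unary.Linked using (Linked)
open import Data.Maybe using (Maybe; just; nothing)
open import Data.Product using (Σ; Σ-syntax; ∃; ∃-syntax; _×_; _,_; proj₁)
open import Data.Sum using (_⊎_)
open import Relation.Nullary using (¬_)
open import Relation.Binary.PropositionalEquality using (_≡_)

-- Generic lattice-theoretic notions for a (finite) poset presented as a
-- preorder _≤_ on a type E; equality of elements is mutual ≤ (_≈_).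

module LatticeNotions (E : Set) (_≤_ : E → E → Set) where

  _≈_ : E → E → Set
  x ≈ y = (x ≤ y) × (y ≤ x)

  _<_ : E → E → Set
  x < y = (x ≤ y) × ¬ (y ≤ x)

  IsLUB : List E → E → Set
  IsLUB xs j = All (_≤ j) xs × (∀ u → All (_≤ u) xs → j ≤ u)

  IsJoin : E → E → E → Set
  IsJoin x y j = IsLUB (x ∷ y ∷ []) j

  IsMeet : E → E → E → Set
  IsMeet x y m = (m ≤ x) × (m ≤ y) × (∀ u → u ≤ x → u ≤ y → u ≤ m)

  IsFinite : Set
  IsFinite = Σ[ xs ∈ List E ] (∀ x → Any (x ≈_) xs)

  IsLattice : Set
  IsLattice = (∀ x y → ∃[ j ] IsJoin x y j) × (∀ x y → ∃[ m ] IsMeet x y m)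

  IsBottom : E → Set
  IsBottom b = ∀ x → b ≤ x

  IsTop : E → Set
  IsTop t = ∀ x → x ≤ t

  _⋖_ : E → E → Set
  x ⋖ y = (x < y) × (∀ z → x < z → ¬ (z < y))

  IsAtom : E → Set
  IsAtom a = ∃[ b ] (IsBottom b × (b ⋖ a))

  -- x is left-modular:  y ∨ (x ∧ z) = (y ∨ x) ∧ z  for all y ≤ z
  LeftModular : E → Set
  LeftModular x = ∀ y z → y ≤ z →
    ∀ m → IsMeet x z m → ∀ j → IsJoin y m j →
    ∀ j' → IsJoin y x j' → ∀ m' → IsMeet j' z m' → j ≈ m'

  IsMaximalChain : (k : ℕ) → (Fin (suc k) → E) → Set
  IsMaximalChain k c =
    IsBottom (c fzero) × IsTop (c (fromℕ k)) ×
    (∀ (i : Fin k) → c (inject₁ i) ⋖ c (fsuc i))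

  module _ {k : ℕ} (c : Fin (suc k) → E) where

    -- atom a lies in level A_{i+1} (levels indexed by Fin k, i.e. 1..k)
    InLevel : E → Fin k → Set
    InLevel a i = IsAtom a × (a ≤ c (fsuc i)) × ¬ (a ≤ c (inject₁ i))

    _◁_ : E → E → Set
    a ◁ b = ∃[ i ] ∃[ j ] ((i <ᶠ j) × InLevel a i × InLevel b j)

    LevelCondition : Set
    LevelCondition = ∀ (a₀ : E) (as : List E) → All IsAtom (a₀ ∷ as) →
      Linked _◁_ (a₀ ∷ as) → ∀ j → IsLUB as j → ¬ (a₀ ≤ j)

  IsLLLattice : Set
  IsLLLattice = IsFinite × IsLattice ×
    (Σ[ k ∈ ℕ ] Σ[ c ∈ (Fin (suc k) → E) ]
       (IsMaximalChain k c × (∀ i → LeftModular (c i)) × LevelCondition c))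

-- binary trees; planarity is irrelevant since the order below only
-- refers to vertices and the "two different child branches" condition
data Tr (n : ℕ) : Set where
  lf : Fin n → Tr n
  nd : Tr n → Tr n → Tr n

leafLabels : ∀ {n} → Tr n → List (Fin n)
leafLabels (lf i) = i ∷ []
leafLabels (nd l r) = leafLabels l Data.List.++ leafLabels r

Forest : ℕ → Set
Forest n = List (Tr n)

IsForestOn : ∀ {n} → Forest n → Set
IsForestOn F = Unique (concatMap leafLabels F) × (∀ i → i ∈ concatMap leafLabels F)

-- non-root vertices of a tree (leaves and inner vertices)
data Node {n : ℕ} : Tr n → Set where
  atLf : ∀ {i} → Node (lf i)
  atNd : ∀ {l r} → Node (nd l r)
  inL  : ∀ {l r} → Node l → Node (nd l r)
  inR  : ∀ {l r} → Node r → Node (nd l r)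

-- inner vertices of a tree
data Pos {n : ℕ} : Tr n → Set where
  here : ∀ {l r} → Pos (nd l r)
  goL  : ∀ {l r} → Pos l → Pos (nd l r)
  goR  : ∀ {l r} → Pos r → Pos (nd l r)

labelOf : ∀ {n} {t : Tr n} → Node t → Maybe (Fin n)
labelOf (atLf {i}) = just i
labelOf atNd = nothing
labelOf (inL u) = labelOf u
labelOf (inR u) = labelOf u

topNode : ∀ {n} (t : Tr n) → Node t
topNode (lf i) = atLf
topNode (nd l r) = atNd

toNode : ∀ {n} {t : Tr n} → Pos t → Node t
toNode here = atNd
toNode (goL p) = inL (toNode p)
toNode (goR p) = inR (toNode p)

lchild : ∀ {n} {t : Tr n} → Pos t → Node t
lchild (here {l}) = inL (topNode l)
lchild (goL p) = inL (lchild p)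
lchild (goR p) = inR (lchild p)

rchild : ∀ {n} {t : Tr n} → Pos t → Node t
rchild (here {r = r}) = inR (topNode r)
rchild (goL p) = inL (rchild p)
rchild (goR p) = inR (rchild p)

data LeftBelow {n : ℕ} : {t : Tr n} → Node t → Node t → Set where
  lb-here : ∀ {l r} {u : Node l} → LeftBelow {t = nd l r} (inL u) atNd
  lb-L : ∀ {l r} {u w : Node l} → LeftBelow u w → LeftBelow {t = nd l r} (inL u) (inL w)
  lb-R : ∀ {l r} {u w : Node r} → LeftBelow u w → LeftBelow {t = nd l r} (inR u) (inR w)

data RightBelow {n : ℕ} : {t : Tr n} → Node t → Node t → Set where
  rb-here : ∀ {l r} {u : Node r} → RightBelow {t = nd l r} (inR u) atNd
  rb-L : ∀ {l r} {u w : Node l} → RightBelow u w → RightBelow {t = nd l r} (inL u) (inL w)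
  rb-R : ∀ {l r} {u w : Node r} → RightBelow u w → RightBelow {t = nd l r} (inR u) (inR w)

Vtx : ∀ {n} → Forest n → Set
Vtx F = Σ[ k ∈ Fin (length F) ] Node (lookup F k)

vlabel : ∀ {n} (F : Forest n) → Vtx F → Maybe (Fin n)
vlabel F (k , u) = labelOf u

data Split {n : ℕ} (G : Forest n) : Vtx G → Vtx G → Vtx G → Set where
  split-lr : ∀ {k a b w} → LeftBelow a w → RightBelow b w → Split G (k , a) (k , b) (k , w)
  split-rl : ∀ {k a b w} → RightBelow a w → LeftBelow b w → Split G (k , a) (k , b) (k , w)

-- F ≤ G : combinatorial data of a map F → G satisfying (D1)-(D4):
-- a vertex map (edges go to the unique monotone paths, roots to points
-- just above the image of the top vertex)
record _≤F_ {n : ℕ} (F G : Forest n) : Set where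
  field
    ψ : Vtx F → Vtx G
    onLeaves : ∀ v i → vlabel F v ≡ just i → vlabel G (ψ v) ≡ just i
    onInner : ∀ v → vlabel F v ≡ nothing → vlabel G (ψ v) ≡ nothing
    innerInj : ∀ v w → vlabel F v ≡ nothing → vlabel F w ≡ nothing → ψ v ≡ ψ w → v ≡ w
    -- (D1)+(D4) increasing and injective on each tree
    onEdges : ∀ (k : Fin (length F)) (p : Pos (lookup F k)) →
      Split G (ψ (k , lchild p)) (ψ (k , rchild p)) (ψ (k , toNode p))

IntervalElt : ∀ {n} → Tr n → Set
IntervalElt {n} T = Σ[ F ∈ Forest n ] (IsForestOn F × (F ≤F (T ∷ [])))

_≤I_ : ∀ {n} {T : Tr n} → IntervalElt T → IntervalElt T → Set
x ≤I y = proj₁ x ≤F proj₁ y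

IsLLLattice : (E : Set) → (E → E → Set) → Set
IsLLLattice E _≤_ = LatticeNotions.IsLLLattice E _≤_

module Submission where

-- A forest below T is determined by which leaves of T lie in a common tree, and the equivalence
-- relations arising in this way are exactly those for which, at every inner vertex of T, at most
-- one class meets both subtrees. Recording at each inner vertex whether, and which, class crosses
-- it gives an explicit lattice of "compatible partitions" that is equivalent to [0̂, T] as a
-- preorder; since the LL property only refers to the order, it transfers along the equivalence.
--
-- In the partition lattice of T = nd a b the maximal chain first runs through the chain of a
-- (with b discrete), then through the chain of b (with a a single block), and ends with the root
-- merge. An element without root merge is left-modular as soon as its two halves are, so all
-- chain elements are left-modular by induction on T. For the level condition, an atom at a level
-- of the first part lives in the left subtree, one at a level of the second part in the right
-- subtree, and root merges occur only at the last level; so an upper bound of a₁, …, a_k above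
-- which a₀ does not lie is obtained from the one given by induction for the relevant subtree,
-- completed by the whole other subtree and the only root merge that can occur among the aᵢ.

open import Data.Nat using (ℕ; zero; suc; _+_; _∸_; _≤_; _<_; z≤n; s≤s; _≤?_)
open import Data.Nat.Properties
  using (≤-refl; ≤-reflexive; ≤-trans; <⇒≤; m≤n⇒m<n∨m≡n; +-suc; +-identityʳ; m+n∸m≡n; +-cancelˡ-≤; ≤-pred; ≰⇒>;
         1+n≰n; m≤m+n; n≤1+n; m+1+n≰m; ≤-<-connex; +-comm; +-cancelˡ-<; ≤-<-trans; <-trans; <⇒≱; +-monoʳ-<; <-cmp)
open import Data.Fin as Fin using (Fin; toℕ)
open import Data.Fin.Properties using (toℕ-fromℕ; toℕ-inject₁; toℕ<n; any?) renaming (_≟_ to _≟ᶠ_)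
open import Data.Unit using (⊤; tt)
open import Data.Empty using (⊥; ⊥-elim)
open import Data.Sum as Sum using (_⊎_; inj₁; inj₂)
open import Data.Product using (Σ-syntax; ∃; ∃₂; ∃-syntax; _×_; _,_; proj₁; proj₂)
open import Data.Maybe using (Maybe; just; nothing)
open import Data.Maybe.Properties using (just-injective)
open import Data.List using (List; []; _∷_; _++_; map; length; lookup; concatMap; deduplicate; cartesianProduct; cartesianProductWith)
open import Data.List.Properties using (++-identityʳ)
open import Data.List.Relation.Unary.All as All using (All; []; _∷_)
import Data.List.Relation.Unary.All.Properties as All
open import Data.List.Relation.Unary.Any as Any using (Any; here; there)
import Data.List.Relation.Unary.Any.Properties as Any
open import Data.List.Relation.Unary.AllPairs using (AllPairs; []; _∷_)
open import Data.List.Relation.Unary.Linked using (Linked; [-]; _∷_)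
open import Data.List.Relation.Unary.Unique.Propositional using (Unique)
open import Data.List.Relation.Unary.Unique.DecSetoid.Properties using (deduplicate-!)
import Data.List.Relation.Unary.Unique.Propositional.Properties as Unique
open import Data.List.Membership.Propositional using (_∈_)
open import Data.List.Relation.Binary.Disjoint.Propositional using (Disjoint)
open import Data.List.Membership.Propositional.Properties
  using (∈-map⁺; ∈-++⁺ˡ; ∈-++⁺ʳ; ∈-++⁻; ∈-cartesianProduct⁺; ∈-cartesianProductWith⁺)
open import Relation.Nullary using (¬_; Dec; yes; no; ¬?; _×-dec_; _→-dec_; decidable-stable)
open import Relation.Unary using (Decidable)
open import Relation.Binary using (Rel; IsDecEquivalence; DecSetoid; tri<; tri≈; tri>)
import Relation.Binary.Construct.On as On
open import Function using (_∘_; _on_)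
open import Level using (0ℓ)
open import Relation.Binary.PropositionalEquality using (_≡_; refl; sym; trans; cong; subst; subst₂)

open import Defs

-- Transfer along an equivalence of preorders

module TransferAlongEquivalence {E M : Set} (_≤_ : E → E → Set) (_⊑_ : M → M → Set)
  (⊑-refl : ∀ {p} → p ⊑ p) (⊑-trans : ∀ {p q r} → p ⊑ q → q ⊑ r → p ⊑ r)
  (g : E → M) (f : M → E)
  (g-mono : ∀ {x y} → x ≤ y → g x ⊑ g y) (g-reflects : ∀ {x y} → g x ⊑ g y → x ≤ y)
  (gf⊑ : ∀ p → g (f p) ⊑ p) (⊑gf : ∀ p → p ⊑ g (f p)) where

  private
    module LE = LatticeNotions E _≤_
    module LM = LatticeNotions M _⊑_

  ≤-f : ∀ {x p} → g x ⊑ p → x ≤ f p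
  ≤-f h = g-reflects (⊑-trans h (⊑gf _))

  f-≤ : ∀ {x p} → p ⊑ g x → f p ≤ x
  f-≤ h = g-reflects (⊑-trans (gf⊑ _) h)

  f-mono : ∀ {p q} → p ⊑ q → f p ≤ f q
  f-mono h = ≤-f (⊑-trans (gf⊑ _) h)

  f-reflects : ∀ {p q} → f p ≤ f q → p ⊑ q
  f-reflects h = ⊑-trans (⊑gf _) (⊑-trans (g-mono h) (gf⊑ _))

  All-g : ∀ {xs : List E} {u} → All (_≤ u) xs → All (_⊑ g u) (map g xs)
  All-g [] = []
  All-g (h ∷ hs) = g-mono h ∷ All-g hs

  All-f : ∀ {xs : List E} {p} → All (_⊑ p) (map g xs) → All (_≤ f p) xs
  All-f {[]} [] = []
  All-f {x ∷ xs} (h ∷ hs) = ≤-f h ∷ All-f hs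

  IsLUB-g : ∀ {xs j} → LE.IsLUB xs j → LM.IsLUB (map g xs) (g j)
  IsLUB-g (ub , least) = All-g ub , λ u hu → ⊑-trans (g-mono (least (f u) (All-f hu))) (gf⊑ u)

  IsMeet-g : ∀ {x z m p} → g x ⊑ p → p ⊑ g x → LE.IsMeet x z m → LM.IsMeet p (g z) (g m)
  IsMeet-g gx⊑p p⊑gx (m≤x , m≤z , greatest) =
    ⊑-trans (g-mono m≤x) gx⊑p , g-mono m≤z ,
    λ u u⊑p u⊑gz → ⊑-trans (⊑gf u) (g-mono (greatest (f u) (f-≤ (⊑-trans u⊑p p⊑gx)) (f-≤ u⊑gz)))

  IsJoin-g : ∀ {y x j p} → g x ⊑ p → p ⊑ g x → LE.IsJoin y x j → LM.IsJoin (g y) p (g j)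
  IsJoin-g gx⊑p p⊑gx ((y≤j ∷ x≤j ∷ []) , least) =
    (g-mono y≤j ∷ ⊑-trans p⊑gx (g-mono x≤j) ∷ []) ,
    λ { u (gy⊑u ∷ p⊑u ∷ []) → ⊑-trans (g-mono (least (f u) (≤-f gy⊑u ∷ ≤-f (⊑-trans gx⊑p p⊑u) ∷ []))) (gf⊑ u) }

  ⋖-f : ∀ {p q} → p LM.⋖ q → f p LE.⋖ f q
  ⋖-f {p} {q} ((p⊑q , q⋢p) , nothing-between) =
    (f-mono p⊑q , λ k → q⋢p (f-reflects k)) ,
    λ z (pz , zp) (zq , qz) →
      nothing-between (g z)
        (⊑-trans (⊑gf p) (g-mono pz) , λ k → zp (g-reflects (⊑-trans k (⊑gf p))))
        (⊑-trans (g-mono zq) (gf⊑ q) , λ k → qz (g-reflects (⊑-trans (gf⊑ q) k)))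

  IsAtom-g : ∀ {a} → LE.IsAtom a → LM.IsAtom (g a)
  IsAtom-g (b , b-bottom , (b≤a , a≰b) , nothing-between) =
    g b , (λ p → ⊑-trans (g-mono (b-bottom (f p))) (gf⊑ p)) ,
    (g-mono b≤a , λ k → a≰b (g-reflects k)) ,
    λ z (bz , zb) (za , az) →
      nothing-between (f z)
        (≤-f bz , λ k → zb (⊑-trans (⊑gf z) (g-mono k)))
        (f-≤ za , λ k → az (⊑-trans (g-mono k) (gf⊑ z)))

  IsLLLattice-transfer : LM.IsLLLattice → LE.IsLLLattice
  IsLLLattice-transfer
    ((xs , listed) , (joins , meets) , k , c , (bottom , top , covers) , leftModular , levelCondition) =
    finite , (joinE , meetE) , k , cE , ((λ x → f-≤ (bottom (g x))) , (λ x → ≤-f (top (g x))) , λ i → ⋖-f (covers i)) ,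
    leftModularE , levelConditionE
    where
    cE : Fin (suc k) → E
    cE i = f (c i)

    finite : LE.IsFinite
    finite = map f xs , λ x → Any-f (listed (g x))
      where
      Any-f : ∀ {x ys} → Any (λ p → (g x ⊑ p) × (p ⊑ g x)) ys → Any (λ y → (x ≤ y) × (y ≤ x)) (map f ys)
      Any-f (here (gx⊑p , p⊑gx)) = here (≤-f gx⊑p , f-≤ p⊑gx)
      Any-f (there h) = there (Any-f h)

    joinE : ∀ x y → ∃[ j ] LE.IsJoin x y j
    joinE x y with joins (g x) (g y)
    ... | j , (h₁ ∷ h₂ ∷ []) , least =
      f j , (≤-f h₁ ∷ ≤-f h₂ ∷ []) , λ { u (u₁ ∷ u₂ ∷ []) → f-≤ (least (g u) (g-mono u₁ ∷ g-mono u₂ ∷ [])) }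

    meetE : ∀ x y → ∃[ m ] LE.IsMeet x y m
    meetE x y with meets (g x) (g y)
    ... | m , h₁ , h₂ , greatest = f m , f-≤ h₁ , f-≤ h₂ , λ u u₁ u₂ → ≤-f (greatest (g u) (g-mono u₁) (g-mono u₂))

    leftModularE : ∀ i → LE.LeftModular (cE i)
    leftModularE i y z y≤z m hm j hj j' hj' m' hm'
      with leftModular i (g y) (g z) (g-mono y≤z)
             (g m) (IsMeet-g (gf⊑ (c i)) (⊑gf (c i)) hm) (g j) (IsJoin-g ⊑-refl ⊑-refl hj)
             (g j') (IsJoin-g (gf⊑ (c i)) (⊑gf (c i)) hj') (g m') (IsMeet-g ⊑-refl ⊑-refl hm')
    ... | j⊑m' , m'⊑j = g-reflects j⊑m' , g-reflects m'⊑j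

    InLevel-g : ∀ {a i} → LE.InLevel cE a i → LM.InLevel c (g a) i
    InLevel-g (atom , below , not-below) = IsAtom-g atom , ⊑-trans (g-mono below) (gf⊑ _) , λ k → not-below (≤-f k)

    Linked-g : ∀ {a as} → Linked (LE._◁_ cE) (a ∷ as) → Linked (LM._◁_ c) (g a ∷ map g as)
    Linked-g [-] = [-]
    Linked-g ((i , j , i<j , la , lb) ∷ l) = (i , j , i<j , InLevel-g la , InLevel-g lb) ∷ Linked-g l

    All-IsAtom-g : ∀ {as} → All LE.IsAtom as → All LM.IsAtom (map g as)
    All-IsAtom-g [] = []
    All-IsAtom-g (h ∷ hs) = IsAtom-g h ∷ All-IsAtom-g hs

    levelConditionE : LE.LevelCondition cE
    levelConditionE a₀ as atoms linked j lub a₀≤j =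
      levelCondition (g a₀) (map g as) (All-IsAtom-g atoms) (Linked-g linked) (g j) (IsLUB-g lub) (g-mono a₀≤j)

Unique-++⁻ : ∀ {A : Set} (xs : List A) {ys} → Unique (xs ++ ys) → Unique xs × Unique ys × Disjoint xs ys
Unique-++⁻ [] u = [] , u , λ ()
Unique-++⁻ (x ∷ xs) (x∉ ∷ u) with Unique-++⁻ xs u
... | u₁ , u₂ , disjoint = All.++⁻ˡ xs x∉ ∷ u₁ , u₂ , λ where
  (here refl , y∈) → All.lookup (All.++⁻ʳ xs x∉) y∈ refl
  (there y∈xs , y∈) → disjoint (y∈xs , y∈)

≤-or-beyond : ∀ k i → i ≤ k ⊎ ∃[ j ] i ≡ k + suc j
≤-or-beyond zero zero = inj₁ z≤n
≤-or-beyond zero (suc i) = inj₂ (i , refl)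
≤-or-beyond (suc k) zero = inj₁ z≤n
≤-or-beyond (suc k) (suc i) = Sum.map s≤s (λ (j , eq) → j , cong suc eq) (≤-or-beyond k i)

offset-lower : ∀ k l {i j} → i ≡ k + suc j → suc (k + l) ≤ i → l ≤ j
offset-lower k l {j = j} eq l< = +-cancelˡ-≤ k _ _ (≤-pred (subst (suc (k + l) ≤_) (trans eq (+-suc k j)) l<))

suc-offset : ∀ k {i j} → i ≡ k + suc j → suc i ≡ k + suc (suc j)
suc-offset k {j = j} eq = trans (cong suc eq) (sym (+-suc k (suc j)))

offset-bound : ∀ k l {i j} → i ≡ k + suc j → suc i ≤ suc (k + l) → suc j ≤ l
offset-bound k l eq i< = +-cancelˡ-≤ k _ _ (≤-pred (subst (λ t → suc t ≤ suc (k + l)) eq i<))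

bothWitnesses : ∀ {A B : Set} {P : A → Set} {Q : B → Set} → Dec (∃ P) → Dec (∃ Q) → Maybe (A × B)
bothWitnesses (yes (x , _)) (yes (y , _)) = just (x , y)
bothWitnesses _ _ = nothing

witnessPair : ∀ {A B : Set} {P : A → B → Set} → Dec (∃₂ P) → Maybe (A × B)
witnessPair (yes (x , y , _)) = just (x , y)
witnessPair (no _) = nothing

-- Compatible partitions of the leaves of a tree

module _ {n : ℕ} where

  Leaf : Tr n → Set
  Leaf (lf i) = ⊤
  Leaf (nd a b) = Leaf a ⊎ Leaf b

  -- At an inner vertex, nothing means that no block meets both subtrees, and just (c , d) that
  -- the block of the left leaf c and the block of the right leaf d are merged into one.
  data Partition : Tr n → Set where
    leaf : ∀ {i} → Partition (lf i)
    node : ∀ {a b} → Partition a → Partition b → Maybe (Leaf a × Leaf b) → Partition (nd a b)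

  SameBlock : ∀ {S} → Partition S → Leaf S → Leaf S → Set
  SameBlock leaf _ _ = ⊤
  SameBlock (node p q m) (inj₁ x) (inj₁ y) = SameBlock p x y
  SameBlock (node p q m) (inj₂ x) (inj₂ y) = SameBlock q x y
  SameBlock (node p q nothing) (inj₁ x) (inj₂ y) = ⊥
  SameBlock (node p q (just (c , d))) (inj₁ x) (inj₂ y) = SameBlock p x c × SameBlock q d y
  SameBlock (node p q nothing) (inj₂ x) (inj₁ y) = ⊥
  SameBlock (node p q (just (c , d))) (inj₂ x) (inj₁ y) = SameBlock q x d × SameBlock p c y

  SameBlock-refl : ∀ {S} (p : Partition S) x → SameBlock p x x
  SameBlock-refl leaf x = tt
  SameBlock-refl (node p q m) (inj₁ x) = SameBlock-refl p x
  SameBlock-refl (node p q m) (inj₂ x) = SameBlock-refl q x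

  SameBlock-sym : ∀ {S} (p : Partition S) x y → SameBlock p x y → SameBlock p y x
  SameBlock-sym leaf x y r = tt
  SameBlock-sym (node p q m) (inj₁ x) (inj₁ y) r = SameBlock-sym p x y r
  SameBlock-sym (node p q m) (inj₂ x) (inj₂ y) r = SameBlock-sym q x y r
  SameBlock-sym (node p q nothing) (inj₁ x) (inj₂ y) ()
  SameBlock-sym (node p q (just (c , d))) (inj₁ x) (inj₂ y) (r₁ , r₂) = SameBlock-sym q d y r₂ , SameBlock-sym p x c r₁
  SameBlock-sym (node p q nothing) (inj₂ x) (inj₁ y) ()
  SameBlock-sym (node p q (just (c , d))) (inj₂ x) (inj₁ y) (r₁ , r₂) = SameBlock-sym p c y r₂ , SameBlock-sym q x d r₁

  SameBlock-trans : ∀ {S} (p : Partition S) x y z → SameBlock p x y → SameBlock p y z → SameBlock p x z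
  SameBlock-trans leaf x y z r s = tt
  SameBlock-trans (node p q m) (inj₁ x) (inj₁ y) (inj₁ z) r s = SameBlock-trans p x y z r s
  SameBlock-trans (node p q m) (inj₂ x) (inj₂ y) (inj₂ z) r s = SameBlock-trans q x y z r s
  SameBlock-trans (node p q (just (c , d))) (inj₁ x) (inj₁ y) (inj₂ z) r (s₁ , s₂) = SameBlock-trans p x y c r s₁ , s₂
  SameBlock-trans (node p q (just (c , d))) (inj₁ x) (inj₂ y) (inj₁ z) (r₁ , r₂) (s₁ , s₂) =
    SameBlock-trans p x c z r₁ s₂
  SameBlock-trans (node p q (just (c , d))) (inj₁ x) (inj₂ y) (inj₂ z) (r₁ , r₂) s = r₁ , SameBlock-trans q d y z r₂ s
  SameBlock-trans (node p q (just (c , d))) (inj₂ x) (inj₁ y) (inj₁ z) (r₁ , r₂) s = r₁ , SameBlock-trans p c y z r₂ s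
  SameBlock-trans (node p q (just (c , d))) (inj₂ x) (inj₁ y) (inj₂ z) (r₁ , r₂) (s₁ , s₂) =
    SameBlock-trans q x d z r₁ s₂
  SameBlock-trans (node p q (just (c , d))) (inj₂ x) (inj₂ y) (inj₁ z) r (s₁ , s₂) = SameBlock-trans q x y d r s₁ , s₂
  SameBlock-trans (node p q nothing) (inj₁ x) (inj₁ y) (inj₂ z) r ()
  SameBlock-trans (node p q nothing) (inj₁ x) (inj₂ y) (inj₁ z) () s
  SameBlock-trans (node p q nothing) (inj₁ x) (inj₂ y) (inj₂ z) () s
  SameBlock-trans (node p q nothing) (inj₂ x) (inj₁ y) (inj₁ z) () s
  SameBlock-trans (node p q nothing) (inj₂ x) (inj₁ y) (inj₂ z) () s
  SameBlock-trans (node p q nothing) (inj₂ x) (inj₂ y) (inj₁ z) r ()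

  search : ∀ S {P : Leaf S → Set} → Decidable P → Dec (∃ P)
  search (lf i) P? with P? tt
  ... | yes p = yes (tt , p)
  ... | no ¬p = no λ { (tt , p) → ¬p p }
  search (nd a b) P? with search a (λ x → P? (inj₁ x)) | search b (λ y → P? (inj₂ y))
  ... | yes (x , px) | _ = yes (inj₁ x , px)
  ... | no _ | yes (y , py) = yes (inj₂ y , py)
  ... | no ¬l | no ¬r = no λ { (inj₁ x , px) → ¬l (x , px) ; (inj₂ y , py) → ¬r (y , py) }

  all? : ∀ S {P : Leaf S → Set} → Decidable P → Dec (∀ x → P x)
  all? S P? with search S (λ x → ¬? (P? x))
  ... | yes (x , ¬px) = no λ h → ¬px (h x)
  ... | no ¬∃ = yes λ x → decidable-stable (P? x) λ ¬px → ¬∃ (x , ¬px)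

  SameBlock? : ∀ {S} (p : Partition S) x y → Dec (SameBlock p x y)
  SameBlock? leaf x y = yes tt
  SameBlock? (node p q m) (inj₁ x) (inj₁ y) = SameBlock? p x y
  SameBlock? (node p q m) (inj₂ x) (inj₂ y) = SameBlock? q x y
  SameBlock? (node p q nothing) (inj₁ x) (inj₂ y) = no (λ ())
  SameBlock? (node p q (just (c , d))) (inj₁ x) (inj₂ y) = SameBlock? p x c ×-dec SameBlock? q d y
  SameBlock? (node p q nothing) (inj₂ x) (inj₁ y) = no (λ ())
  SameBlock? (node p q (just (c , d))) (inj₂ x) (inj₁ y) = SameBlock? q x d ×-dec SameBlock? p c y

  blocks-decSetoid : ∀ {S} → Partition S → DecSetoid 0ℓ 0ℓ
  blocks-decSetoid {S} p = record
    { Carrier = Leaf S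
    ; _≈_ = SameBlock p
    ; isDecEquivalence = record
      { isEquivalence = record
        { refl = λ {x} → SameBlock-refl p x ; sym = λ {x} {y} → SameBlock-sym p x y ; trans = λ {x} {y} {z} → SameBlock-trans p x y z }
      ; _≟_ = SameBlock? p } }

  infix 4 _⊑_
  record _⊑_ {S} (p q : Partition S) : Set where
    constructor mk⊑
    field ⊑-sameBlock : ∀ x y → SameBlock p x y → SameBlock q x y
  open _⊑_ public

  _⊑?_ : ∀ {S} (p q : Partition S) → Dec (p ⊑ q)
  _⊑?_ {S} p q with all? S (λ x → all? S (λ y → SameBlock? p x y →-dec SameBlock? q x y))
  ... | yes h = yes (mk⊑ h)
  ... | no nh = no (λ h → nh (⊑-sameBlock h))

  ⊑-refl : ∀ {S} (p : Partition S) → p ⊑ p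
  ⊑-refl p = mk⊑ (λ x y r → r)

  ⊑-trans : ∀ {S} {p q r : Partition S} → p ⊑ q → q ⊑ r → p ⊑ r
  ⊑-trans a b = mk⊑ (λ x y h → ⊑-sameBlock b x y (⊑-sameBlock a x y h))

  MergeIn : ∀ {a b} → Maybe (Leaf a × Leaf b) → Partition (nd a b) → Set
  MergeIn nothing u = ⊤
  MergeIn (just (c , d)) u = SameBlock u (inj₁ c) (inj₂ d)

  node-mono : ∀ {a b} {p p' : Partition a} {q q' : Partition b} {m m'} →
    p ⊑ p' → q ⊑ q' → MergeIn m (node p' q' m') → node p q m ⊑ node p' q' m'
  node-mono {p = p} {p'} {q} {q'} {m} {m'} h₁ h₂ hc = mk⊑ (preserved m hc)
    where
    preserved : ∀ m → MergeIn m (node p' q' m') → ∀ x y → SameBlock (node p q m) x y → SameBlock (node p' q' m') x y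
    preserved m hc (inj₁ x) (inj₁ y) r = ⊑-sameBlock h₁ x y r
    preserved m hc (inj₂ x) (inj₂ y) r = ⊑-sameBlock h₂ x y r
    preserved (just (c , d)) hc (inj₁ x) (inj₂ y) (r₁ , r₂) =
      SameBlock-trans (node p' q' m') (inj₁ x) (inj₁ c) (inj₂ y) (⊑-sameBlock h₁ x c r₁)
        (SameBlock-trans (node p' q' m') (inj₁ c) (inj₂ d) (inj₂ y) hc (⊑-sameBlock h₂ d y r₂))
    preserved (just (c , d)) hc (inj₂ x) (inj₁ y) (r₁ , r₂) =
      SameBlock-trans (node p' q' m') (inj₂ x) (inj₂ d) (inj₁ y) (⊑-sameBlock h₂ x d r₁)
        (SameBlock-trans (node p' q' m') (inj₂ d) (inj₁ c) (inj₁ y)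
          (SameBlock-sym (node p' q' m') (inj₁ c) (inj₂ d) hc) (⊑-sameBlock h₁ c y r₂))

  ⊑-left : ∀ {a b} {p p' : Partition a} {q q' : Partition b} {m m'} → node p q m ⊑ node p' q' m' → p ⊑ p'
  ⊑-left h = mk⊑ (λ x y r → ⊑-sameBlock h (inj₁ x) (inj₁ y) r)

  ⊑-right : ∀ {a b} {p p' : Partition a} {q q' : Partition b} {m m'} → node p q m ⊑ node p' q' m' → q ⊑ q'
  ⊑-right h = mk⊑ (λ x y r → ⊑-sameBlock h (inj₂ x) (inj₂ y) r)

  ⊑-merge : ∀ {a b} {p p' : Partition a} {q q' : Partition b} {m m'} → node p q m ⊑ node p' q' m' → MergeIn m (node p' q' m')
  ⊑-merge {p = p} {q = q} {m = nothing} h = tt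
  ⊑-merge {p = p} {q = q} {m = just (c , d)} h = ⊑-sameBlock h (inj₁ c) (inj₂ d) (SameBlock-refl p c , SameBlock-refl q d)

  discrete : ∀ S → Partition S
  discrete (lf i) = leaf
  discrete (nd a b) = node (discrete a) (discrete b) nothing

  discrete-⊑ : ∀ {S} (u : Partition S) → discrete S ⊑ u
  discrete-⊑ leaf = mk⊑ (λ x y r → tt)
  discrete-⊑ (node u₁ u₂ m) = node-mono {m = nothing} (discrete-⊑ u₁) (discrete-⊑ u₂) tt

  someLeaf : ∀ S → Leaf S
  someLeaf (lf i) = tt
  someLeaf (nd a b) = inj₁ (someLeaf a)

  whole : ∀ S → Partition S
  whole (lf i) = leaf
  whole (nd a b) = node (whole a) (whole b) (just (someLeaf a , someLeaf b))

  whole-sameBlock : ∀ {S} (x y : Leaf S) → SameBlock (whole S) x y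
  whole-sameBlock {lf i} x y = tt
  whole-sameBlock {nd a b} (inj₁ x) (inj₁ y) = whole-sameBlock x y
  whole-sameBlock {nd a b} (inj₂ x) (inj₂ y) = whole-sameBlock x y
  whole-sameBlock {nd a b} (inj₁ x) (inj₂ y) = whole-sameBlock x (someLeaf a) , whole-sameBlock (someLeaf b) y
  whole-sameBlock {nd a b} (inj₂ x) (inj₁ y) = whole-sameBlock x (someLeaf b) , whole-sameBlock (someLeaf a) y

  ⊑-whole : ∀ {S} (u : Partition S) → u ⊑ whole S
  ⊑-whole u = mk⊑ (λ x y _ → whole-sameBlock x y)

  link : ∀ {S} → Leaf S → Leaf S → Partition S
  link {lf i} x y = leaf
  link {nd a b} (inj₁ x) (inj₁ y) = node (link x y) (discrete b) nothing
  link {nd a b} (inj₂ x) (inj₂ y) = node (discrete a) (link x y) nothing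
  link {nd a b} (inj₁ x) (inj₂ y) = node (discrete a) (discrete b) (just (x , y))
  link {nd a b} (inj₂ y) (inj₁ x) = node (discrete a) (discrete b) (just (x , y))

  link-sameBlock : ∀ {S} (x y : Leaf S) → SameBlock (link x y) x y
  link-sameBlock {lf i} x y = tt
  link-sameBlock {nd a b} (inj₁ x) (inj₁ y) = link-sameBlock x y
  link-sameBlock {nd a b} (inj₂ x) (inj₂ y) = link-sameBlock x y
  link-sameBlock {nd a b} (inj₁ x) (inj₂ y) = SameBlock-refl (discrete a) x , SameBlock-refl (discrete b) y
  link-sameBlock {nd a b} (inj₂ y) (inj₁ x) = SameBlock-refl (discrete b) y , SameBlock-refl (discrete a) x

  link-least : ∀ {S} (u : Partition S) (x y : Leaf S) → SameBlock u x y → link x y ⊑ u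
  link-least leaf x y h = mk⊑ (λ s t r → tt)
  link-least (node u₁ u₂ m) (inj₁ x) (inj₁ y) h =
    node-mono {m = nothing} (link-least u₁ x y h) (discrete-⊑ u₂) tt
  link-least (node u₁ u₂ m) (inj₂ x) (inj₂ y) h =
    node-mono {m = nothing} (discrete-⊑ u₁) (link-least u₂ x y h) tt
  link-least (node u₁ u₂ m) (inj₁ x) (inj₂ y) h = node-mono (discrete-⊑ u₁) (discrete-⊑ u₂) h
  link-least (node u₁ u₂ m) (inj₂ y) (inj₁ x) h =
    node-mono (discrete-⊑ u₁) (discrete-⊑ u₂) (SameBlock-sym (node u₁ u₂ m) (inj₂ y) (inj₁ x) h)

  InBoth : ∀ {S} → Partition S → Partition S → Leaf S → Leaf S → Leaf S → Set
  InBoth p p' c c' x = SameBlock p c x × SameBlock p' c' x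

  InBoth? : ∀ {S} (p p' : Partition S) c c' → Dec (∃ (InBoth p p' c c'))
  InBoth? {S} p p' c c' = search S (λ x → SameBlock? p c x ×-dec SameBlock? p' c' x)

  meetMerge : ∀ {a b} (p p' : Partition a) (q q' : Partition b) → (m m' : Maybe (Leaf a × Leaf b)) → Maybe (Leaf a × Leaf b)
  meetMerge p p' q q' (just (c , d)) (just (c' , d')) = bothWitnesses (InBoth? p p' c c') (InBoth? q q' d d')
  meetMerge p p' q q' _ _ = nothing

  infixl 7 _⊓_
  _⊓_ : ∀ {S} → Partition S → Partition S → Partition S
  leaf ⊓ leaf = leaf
  node p q m ⊓ node p' q' m' = node (p ⊓ p') (q ⊓ q') (meetMerge p p' q q' m m')

  module _ {a b} (p₁ q₁ : Partition a) (p₂ q₂ : Partition b) where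

    bothWitnesses-merge⁻ : ∀ c d c' d' (l : Dec (∃ (InBoth p₁ q₁ c c'))) (r : Dec (∃ (InBoth p₂ q₂ d d'))) →
      (∀ x y → SameBlock (p₁ ⊓ q₁) x y → SameBlock p₁ x y × SameBlock q₁ x y) →
      (∀ x y → SameBlock (p₂ ⊓ q₂) x y → SameBlock p₂ x y × SameBlock q₂ x y) →
      ∀ x y → SameBlock (node (p₁ ⊓ q₁) (p₂ ⊓ q₂) (bothWitnesses l r)) (inj₁ x) (inj₂ y) →
      (SameBlock p₁ x c × SameBlock p₂ d y) × (SameBlock q₁ x c' × SameBlock q₂ d' y)
    bothWitnesses-merge⁻ c d c' d' (yes (e , ce , c'e)) (yes (f , df , d'f)) ih₁ ih₂ x y (xe , fy)
      with ih₁ x e xe | ih₂ f y fy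
    ... | pxe , qxe | pfy , qfy =
      (SameBlock-trans p₁ x e c pxe (SameBlock-sym p₁ c e ce) , SameBlock-trans p₂ d f y df pfy) ,
      (SameBlock-trans q₁ x e c' qxe (SameBlock-sym q₁ c' e c'e) , SameBlock-trans q₂ d' f y d'f qfy)

    bothWitnesses-merge⁺ : ∀ c d c' d' (l : Dec (∃ (InBoth p₁ q₁ c c'))) (r : Dec (∃ (InBoth p₂ q₂ d d'))) →
      (∀ x y → SameBlock p₁ x y → SameBlock q₁ x y → SameBlock (p₁ ⊓ q₁) x y) →
      (∀ x y → SameBlock p₂ x y → SameBlock q₂ x y → SameBlock (p₂ ⊓ q₂) x y) →
      ∀ x y → SameBlock p₁ x c → SameBlock p₂ d y → SameBlock q₁ x c' → SameBlock q₂ d' y →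
      SameBlock (node (p₁ ⊓ q₁) (p₂ ⊓ q₂) (bothWitnesses l r)) (inj₁ x) (inj₂ y)
    bothWitnesses-merge⁺ c d c' d' (yes (e , ce , c'e)) (yes (f , df , d'f)) ih₁ ih₂ x y xc dy xc' d'y =
      ih₁ x e (SameBlock-trans p₁ x c e xc ce) (SameBlock-trans q₁ x c' e xc' c'e) ,
      ih₂ f y (SameBlock-trans p₂ f d y (SameBlock-sym p₂ d f df) dy) (SameBlock-trans q₂ f d' y (SameBlock-sym q₂ d' f d'f) d'y)
    bothWitnesses-merge⁺ c d c' d' (yes _) (no ¬r) ih₁ ih₂ x y xc dy xc' d'y = ¬r (y , dy , d'y)
    bothWitnesses-merge⁺ c d c' d' (no ¬l) r ih₁ ih₂ x y xc dy xc' d'y =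
      ¬l (x , SameBlock-sym p₁ x c xc , SameBlock-sym q₁ x c' xc')

    meetMerge⁻ : ∀ m m' →
      (∀ x y → SameBlock (p₁ ⊓ q₁) x y → SameBlock p₁ x y × SameBlock q₁ x y) →
      (∀ x y → SameBlock (p₂ ⊓ q₂) x y → SameBlock p₂ x y × SameBlock q₂ x y) →
      ∀ x y → SameBlock (node p₁ p₂ m ⊓ node q₁ q₂ m') (inj₁ x) (inj₂ y) →
      SameBlock (node p₁ p₂ m) (inj₁ x) (inj₂ y) × SameBlock (node q₁ q₂ m') (inj₁ x) (inj₂ y)
    meetMerge⁻ (just (c , d)) (just (c' , d')) ih₁ ih₂ x y r
      with bothWitnesses-merge⁻ c d c' d' (InBoth? p₁ q₁ c c') (InBoth? p₂ q₂ d d') ih₁ ih₂ x y r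
    ... | (pxc , pdy) , (qxc' , qd'y) = (pxc , pdy) , (qxc' , qd'y)

    meetMerge⁺ : ∀ m m' →
      (∀ x y → SameBlock p₁ x y → SameBlock q₁ x y → SameBlock (p₁ ⊓ q₁) x y) →
      (∀ x y → SameBlock p₂ x y → SameBlock q₂ x y → SameBlock (p₂ ⊓ q₂) x y) →
      ∀ x y → SameBlock (node p₁ p₂ m) (inj₁ x) (inj₂ y) → SameBlock (node q₁ q₂ m') (inj₁ x) (inj₂ y) →
      SameBlock (node p₁ p₂ m ⊓ node q₁ q₂ m') (inj₁ x) (inj₂ y)
    meetMerge⁺ (just (c , d)) (just (c' , d')) ih₁ ih₂ x y (xc , dy) (xc' , d'y) =
      bothWitnesses-merge⁺ c d c' d' (InBoth? p₁ q₁ c c') (InBoth? p₂ q₂ d d') ih₁ ih₂ x y xc dy xc' d'y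

  SameBlock-⊓⁻ : ∀ {S} (p q : Partition S) x y → SameBlock (p ⊓ q) x y → SameBlock p x y × SameBlock q x y
  SameBlock-⊓⁻ leaf leaf x y r = tt , tt
  SameBlock-⊓⁻ (node p₁ p₂ m) (node q₁ q₂ m') (inj₁ x) (inj₁ y) r = SameBlock-⊓⁻ p₁ q₁ x y r
  SameBlock-⊓⁻ (node p₁ p₂ m) (node q₁ q₂ m') (inj₂ x) (inj₂ y) r = SameBlock-⊓⁻ p₂ q₂ x y r
  SameBlock-⊓⁻ (node p₁ p₂ m) (node q₁ q₂ m') (inj₁ x) (inj₂ y) r =
    meetMerge⁻ p₁ q₁ p₂ q₂ m m' (SameBlock-⊓⁻ p₁ q₁) (SameBlock-⊓⁻ p₂ q₂) x y r
  SameBlock-⊓⁻ (node p₁ p₂ m) (node q₁ q₂ m') (inj₂ y) (inj₁ x) r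
    with meetMerge⁻ p₁ q₁ p₂ q₂ m m' (SameBlock-⊓⁻ p₁ q₁) (SameBlock-⊓⁻ p₂ q₂) x y
           (SameBlock-sym (node p₁ p₂ m ⊓ node q₁ q₂ m') (inj₂ y) (inj₁ x) r)
  ... | r₁ , r₂ = SameBlock-sym (node p₁ p₂ m) (inj₁ x) (inj₂ y) r₁ , SameBlock-sym (node q₁ q₂ m') (inj₁ x) (inj₂ y) r₂

  SameBlock-⊓⁺ : ∀ {S} (p q : Partition S) x y → SameBlock p x y → SameBlock q x y → SameBlock (p ⊓ q) x y
  SameBlock-⊓⁺ leaf leaf x y r s = tt
  SameBlock-⊓⁺ (node p₁ p₂ m) (node q₁ q₂ m') (inj₁ x) (inj₁ y) r s = SameBlock-⊓⁺ p₁ q₁ x y r s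
  SameBlock-⊓⁺ (node p₁ p₂ m) (node q₁ q₂ m') (inj₂ x) (inj₂ y) r s = SameBlock-⊓⁺ p₂ q₂ x y r s
  SameBlock-⊓⁺ (node p₁ p₂ m) (node q₁ q₂ m') (inj₁ x) (inj₂ y) r s =
    meetMerge⁺ p₁ q₁ p₂ q₂ m m' (SameBlock-⊓⁺ p₁ q₁) (SameBlock-⊓⁺ p₂ q₂) x y r s
  SameBlock-⊓⁺ (node p₁ p₂ m) (node q₁ q₂ m') (inj₂ y) (inj₁ x) r s =
    SameBlock-sym (node p₁ p₂ m ⊓ node q₁ q₂ m') (inj₁ x) (inj₂ y)
      (meetMerge⁺ p₁ q₁ p₂ q₂ m m' (SameBlock-⊓⁺ p₁ q₁) (SameBlock-⊓⁺ p₂ q₂) x y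
        (SameBlock-sym (node p₁ p₂ m) (inj₂ y) (inj₁ x) r) (SameBlock-sym (node q₁ q₂ m') (inj₂ y) (inj₁ x) s))

  ⊓-lowerˡ : ∀ {S} (p q : Partition S) → p ⊓ q ⊑ p
  ⊓-lowerˡ p q = mk⊑ (λ x y r → proj₁ (SameBlock-⊓⁻ p q x y r))
  ⊓-lowerʳ : ∀ {S} (p q : Partition S) → p ⊓ q ⊑ q
  ⊓-lowerʳ p q = mk⊑ (λ x y r → proj₂ (SameBlock-⊓⁻ p q x y r))
  ⊓-greatest : ∀ {S} {p q u : Partition S} → u ⊑ p → u ⊑ q → u ⊑ p ⊓ q
  ⊓-greatest {p = p} {q} h₁ h₂ = mk⊑ (λ x y r → SameBlock-⊓⁺ p q x y (⊑-sameBlock h₁ x y r) (⊑-sameBlock h₂ x y r))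

  infixl 6 _⊔_
  _⊔_ : ∀ {S} → Partition S → Partition S → Partition S
  leaf ⊔ leaf = leaf
  node p q nothing ⊔ node p' q' m' = node (p ⊔ p') (q ⊔ q') m'
  node p q (just cd) ⊔ node p' q' nothing = node (p ⊔ p') (q ⊔ q') (just cd)
  node p q (just (c , d)) ⊔ node p' q' (just (c' , d')) =
    node (p ⊔ p' ⊔ link c c') (q ⊔ q' ⊔ link d d') (just (c , d))

  merge-sameBlockˡ : ∀ {a b} (u₁ : Partition a) (u₂ : Partition b) m c d c' d' →
    SameBlock (node u₁ u₂ m) (inj₁ c) (inj₂ d) → SameBlock (node u₁ u₂ m) (inj₁ c') (inj₂ d') → SameBlock u₁ c c'
  merge-sameBlockˡ u₁ u₂ (just (e , f)) c d c' d' (ce , _) (c'e , _) = SameBlock-trans u₁ c e c' ce (SameBlock-sym u₁ c' e c'e)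

  merge-sameBlockʳ : ∀ {a b} (u₁ : Partition a) (u₂ : Partition b) m c d c' d' →
    SameBlock (node u₁ u₂ m) (inj₁ c) (inj₂ d) → SameBlock (node u₁ u₂ m) (inj₁ c') (inj₂ d') → SameBlock u₂ d d'
  merge-sameBlockʳ u₁ u₂ (just (e , f)) c d c' d' (_ , fd) (_ , fd') = SameBlock-trans u₂ d f d' (SameBlock-sym u₂ f d fd) fd'

  ⊔-upperˡ : ∀ {S} (p q : Partition S) → p ⊑ p ⊔ q
  ⊔-upperʳ : ∀ {S} (p q : Partition S) → q ⊑ p ⊔ q

  ⊔-upperˡ leaf leaf = ⊑-refl leaf
  ⊔-upperˡ (node p q nothing) (node p' q' m') = node-mono (⊔-upperˡ p p') (⊔-upperˡ q q') tt
  ⊔-upperˡ (node p q (just (c , d))) (node p' q' nothing) =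
    node-mono (⊔-upperˡ p p') (⊔-upperˡ q q') (SameBlock-refl (p ⊔ p') c , SameBlock-refl (q ⊔ q') d)
  ⊔-upperˡ (node p q (just (c , d))) (node p' q' (just (c' , d'))) =
    node-mono (⊑-trans (⊔-upperˡ p p') (⊔-upperˡ (p ⊔ p') (link c c')))
              (⊑-trans (⊔-upperˡ q q') (⊔-upperˡ (q ⊔ q') (link d d')))
              (SameBlock-refl (p ⊔ p' ⊔ link c c') c , SameBlock-refl (q ⊔ q' ⊔ link d d') d)

  ⊔-upperʳ leaf leaf = ⊑-refl leaf
  ⊔-upperʳ (node p q nothing) (node p' q' nothing) = node-mono (⊔-upperʳ p p') (⊔-upperʳ q q') tt
  ⊔-upperʳ (node p q nothing) (node p' q' (just (c , d))) =
    node-mono (⊔-upperʳ p p') (⊔-upperʳ q q') (SameBlock-refl (p ⊔ p') c , SameBlock-refl (q ⊔ q') d)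
  ⊔-upperʳ (node p q (just (c , d))) (node p' q' nothing) = node-mono (⊔-upperʳ p p') (⊔-upperʳ q q') tt
  ⊔-upperʳ (node p q (just (c , d))) (node p' q' (just (c' , d'))) =
    node-mono (⊑-trans (⊔-upperʳ p p') (⊔-upperˡ (p ⊔ p') (link c c')))
              (⊑-trans (⊔-upperʳ q q') (⊔-upperˡ (q ⊔ q') (link d d')))
              (SameBlock-sym (p ⊔ p' ⊔ link c c') c c' (⊑-sameBlock (⊔-upperʳ (p ⊔ p') (link c c')) c c' (link-sameBlock c c')) ,
               ⊑-sameBlock (⊔-upperʳ (q ⊔ q') (link d d')) d d' (link-sameBlock d d'))

  ⊔-least : ∀ {S} (p q u : Partition S) → p ⊑ u → q ⊑ u → p ⊔ q ⊑ u
  ⊔-least leaf leaf u _ _ = discrete-⊑ u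
  ⊔-least (node p q nothing) (node p' q' nothing) (node u₁ u₂ m) h h' =
    node-mono (⊔-least p p' u₁ (⊑-left h) (⊑-left h')) (⊔-least q q' u₂ (⊑-right h) (⊑-right h')) tt
  ⊔-least (node p q nothing) (node p' q' (just (c , d))) (node u₁ u₂ m) h h' =
    node-mono (⊔-least p p' u₁ (⊑-left h) (⊑-left h')) (⊔-least q q' u₂ (⊑-right h) (⊑-right h')) (⊑-merge h')
  ⊔-least (node p q (just (c , d))) (node p' q' nothing) (node u₁ u₂ m) h h' =
    node-mono (⊔-least p p' u₁ (⊑-left h) (⊑-left h')) (⊔-least q q' u₂ (⊑-right h) (⊑-right h')) (⊑-merge h)
  ⊔-least (node p q (just (c , d))) (node p' q' (just (c' , d'))) (node u₁ u₂ m) h h' =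
    node-mono (⊔-least (p ⊔ p') (link c c') u₁ (⊔-least p p' u₁ (⊑-left h) (⊑-left h')) (link-least u₁ c c' cc'))
              (⊔-least (q ⊔ q') (link d d') u₂ (⊔-least q q' u₂ (⊑-right h) (⊑-right h')) (link-least u₂ d d' dd'))
              (⊑-merge h)
    where
    cc' : SameBlock u₁ c c'
    cc' = merge-sameBlockˡ u₁ u₂ m c d c' d' (⊑-merge h) (⊑-merge h')
    dd' : SameBlock u₂ d d'
    dd' = merge-sameBlockʳ u₁ u₂ m c d c' d' (⊑-merge h) (⊑-merge h')

  ⊔-discrete : ∀ {S} (y : Partition S) → y ⊔ discrete S ⊑ y
  ⊔-discrete {S} y = ⊔-least y (discrete S) y (⊑-refl y) (discrete-⊑ y)

  ⊓-whole : ∀ {S} (z : Partition S) → z ⊑ whole S ⊓ z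
  ⊓-whole z = ⊓-greatest (⊑-whole z) (⊑-refl z)

  LeftModularᵖ : ∀ {S} → Partition S → Set
  LeftModularᵖ {S} x = ∀ (y z : Partition S) → y ⊑ z → (y ⊔ x) ⊓ z ⊑ y ⊔ (x ⊓ z)

  bothWitnesses-in : ∀ {a b} {P : Leaf a → Set} {Q : Leaf b → Set} (l : Dec (∃ P)) (r : Dec (∃ Q)) (u : Partition (nd a b)) →
    (∀ e f → P e → Q f → SameBlock u (inj₁ e) (inj₂ f)) → MergeIn (bothWitnesses l r) u
  bothWitnesses-in (yes (e , pe)) (yes (f , qf)) u h = h e f pe qf
  bothWitnesses-in (yes _) (no _) u h = tt
  bothWitnesses-in (no _) _ u h = tt

  LeftModularᵖ-node : ∀ {a b} {x₁ : Partition a} {x₂ : Partition b} →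
    LeftModularᵖ x₁ → LeftModularᵖ x₂ → LeftModularᵖ (node x₁ x₂ nothing)
  LeftModularᵖ-node lm₁ lm₂ (node y₁ y₂ nothing) (node z₁ z₂ mz) y⊑z =
    node-mono (lm₁ y₁ z₁ (⊑-left y⊑z)) (lm₂ y₂ z₂ (⊑-right y⊑z)) tt
  LeftModularᵖ-node lm₁ lm₂ (node y₁ y₂ (just _)) (node z₁ z₂ nothing) y⊑z = ⊥-elim (⊑-merge y⊑z)
  LeftModularᵖ-node {x₁ = x₁} {x₂} lm₁ lm₂ (node y₁ y₂ (just (c , d))) (node z₁ z₂ (just (c' , d'))) y⊑z =
    node-mono (lm₁ y₁ z₁ (⊑-left y⊑z)) (lm₂ y₂ z₂ (⊑-right y⊑z))
      (bothWitnesses-in (InBoth? (y₁ ⊔ x₁) z₁ c c') (InBoth? (y₂ ⊔ x₂) z₂ d d') _ merged)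
    where
    cc' = proj₁ (⊑-merge y⊑z)
    d'd = proj₂ (⊑-merge y⊑z)
    merged : ∀ e f → InBoth (y₁ ⊔ x₁) z₁ c c' e → InBoth (y₂ ⊔ x₂) z₂ d d' f →
      SameBlock (y₁ ⊔ x₁ ⊓ z₁) e c × SameBlock (y₂ ⊔ x₂ ⊓ z₂) d f
    merged e f (ce , c'e) (df , d'f) =
      ⊑-sameBlock (lm₁ y₁ z₁ (⊑-left y⊑z)) e c
        (SameBlock-⊓⁺ (y₁ ⊔ x₁) z₁ e c (SameBlock-sym (y₁ ⊔ x₁) c e ce)
          (SameBlock-sym z₁ c e (SameBlock-trans z₁ c c' e cc' c'e))) ,
      ⊑-sameBlock (lm₂ y₂ z₂ (⊑-right y⊑z)) d f
        (SameBlock-⊓⁺ (y₂ ⊔ x₂) z₂ d f df (SameBlock-trans z₂ d d' f (SameBlock-sym z₂ d' d d'd) d'f))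

  LeftModularᵖ-discrete : ∀ S → LeftModularᵖ (discrete S)
  LeftModularᵖ-discrete S y z _ =
    ⊑-trans (⊓-lowerˡ (y ⊔ discrete S) z) (⊑-trans (⊔-discrete y) (⊔-upperˡ y (discrete S ⊓ z)))

  LeftModularᵖ-whole : ∀ S → LeftModularᵖ (whole S)
  LeftModularᵖ-whole S y z _ =
    ⊑-trans (⊓-lowerʳ (y ⊔ whole S) z) (⊑-trans (⊓-whole z) (⊔-upperʳ y (whole S ⊓ z)))

  -- The maximal chain
  rank : Tr n → ℕ
  rank (lf i) = 0
  rank (nd a b) = suc (rank a + rank b)

  chain : ∀ S → ℕ → Partition S
  chainFrom : ∀ a b (i : ℕ) → Dec (i ≤ rank a) → Partition (nd a b)
  chainRight : ∀ a b (j : ℕ) → Dec (j ≤ rank b) → Partition (nd a b)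
  chain (lf i) _ = leaf
  chain (nd a b) i = chainFrom a b i (i ≤? rank a)
  chainFrom a b i (yes _) = node (chain a i) (discrete b) nothing
  chainFrom a b i (no _) = chainRight a b (i ∸ rank a) (i ∸ rank a ≤? rank b)
  chainRight a b j (yes _) = node (whole a) (chain b j) nothing
  chainRight a b j (no _) = whole (nd a b)

  chain-left : ∀ a b i → i ≤ rank a → chain (nd a b) i ≡ node (chain a i) (discrete b) nothing
  chain-left a b i i≤ with i ≤? rank a
  ... | yes _ = refl
  ... | no i≰ = ⊥-elim (i≰ i≤)

  chain-right : ∀ a b i j → i ≡ rank a + suc j → suc j ≤ rank b → chain (nd a b) i ≡ node (whole a) (chain b (suc j)) nothing
  chain-right a b .(rank a + suc j) j refl j< with rank a + suc j ≤? rank a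
  ... | yes i≤ = ⊥-elim (m+1+n≰m (rank a) i≤)
  ... | no _ rewrite m+n∸m≡n (rank a) (suc j) with suc j ≤? rank b
  ...   | yes _ = refl
  ...   | no j≮ = ⊥-elim (j≮ j<)

  chain-whole : ∀ a b i j → i ≡ rank a + suc j → rank b ≤ j → chain (nd a b) i ≡ whole (nd a b)
  chain-whole a b .(rank a + suc j) j refl ≤j with rank a + suc j ≤? rank a
  ... | yes i≤ = ⊥-elim (m+1+n≰m (rank a) i≤)
  ... | no _ rewrite m+n∸m≡n (rank a) (suc j) with suc j ≤? rank b
  ...   | yes j< = ⊥-elim (1+n≰n (≤-trans j< ≤j))
  ...   | no _ = refl

  chain-leftModular : ∀ S i → LeftModularᵖ (chain S i)
  chain-leftModular (lf x) i leaf leaf _ = ⊑-refl leaf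
  chain-leftModular (nd a b) i with ≤-or-beyond (rank a) i
  ... | inj₁ i≤ rewrite chain-left a b i i≤ =
    LeftModularᵖ-node (chain-leftModular a i) (LeftModularᵖ-discrete b)
  ... | inj₂ (j , eq) with suc j ≤? rank b
  ...   | yes j< rewrite chain-right a b i j eq j< =
    LeftModularᵖ-node (LeftModularᵖ-whole a) (chain-leftModular b (suc j))
  ...   | no j≮ rewrite chain-whole a b i j eq (≤-pred (≰⇒> j≮)) = LeftModularᵖ-whole (nd a b)

  Covers : ∀ {S} → Partition S → Partition S → Set
  Covers {S} x y = x ⊑ y × ¬ (y ⊑ x) × (∀ (z : Partition S) → x ⊑ z → z ⊑ y → z ⊑ x ⊎ y ⊑ z)

  ⊑-unmerged : ∀ {a b} {p : Partition a} {q : Partition b} {z : Partition (nd a b)} → z ⊑ node p q nothing →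
    ∃₂ λ z₁ z₂ → z ≡ node z₁ z₂ nothing
  ⊑-unmerged {z = node z₁ z₂ nothing} _ = z₁ , z₂ , refl
  ⊑-unmerged {z = node z₁ z₂ (just _)} h = ⊥-elim (⊑-merge h)

  Covers-left : ∀ {a b} {x₁ y₁ : Partition a} → Covers x₁ y₁ →
    Covers (node x₁ (discrete b) nothing) (node y₁ (discrete b) nothing)
  Covers-left {b = b} (x⊑y , y⋢x , between) =
    node-mono x⊑y (⊑-refl (discrete b)) tt , (λ h → y⋢x (⊑-left h)) , between'
    where
    between' : ∀ z → _ ⊑ z → z ⊑ _ → z ⊑ _ ⊎ _ ⊑ z
    between' z x⊑z z⊑y with ⊑-unmerged z⊑y
    ... | z₁ , z₂ , refl = Sum.map (λ k → node-mono k (⊑-right z⊑y) tt) (λ k → node-mono k (discrete-⊑ z₂) tt)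
                                   (between z₁ (⊑-left x⊑z) (⊑-left z⊑y))

  Covers-right : ∀ {a b} {x₂ y₂ : Partition b} → Covers x₂ y₂ →
    Covers (node (whole a) x₂ nothing) (node (whole a) y₂ nothing)
  Covers-right {a} (x⊑y , y⋢x , between) =
    node-mono (⊑-refl (whole a)) x⊑y tt , (λ h → y⋢x (⊑-right h)) , between'
    where
    between' : ∀ z → _ ⊑ z → z ⊑ _ → z ⊑ _ ⊎ _ ⊑ z
    between' z x⊑z z⊑y with ⊑-unmerged z⊑y
    ... | z₁ , z₂ , refl = Sum.map (λ k → node-mono (⊑-whole z₁) k tt) (λ k → node-mono (⊑-left x⊑z) k tt)
                                   (between z₂ (⊑-right x⊑z) (⊑-right z⊑y))

  Covers-merge : ∀ a b → Covers (node (whole a) (whole b) nothing) (whole (nd a b))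
  Covers-merge a b = ⊑-whole _ , ⊑-merge , between
    where
    between : ∀ z → node (whole a) (whole b) nothing ⊑ z → z ⊑ whole (nd a b) →
      z ⊑ node (whole a) (whole b) nothing ⊎ whole (nd a b) ⊑ z
    between (node z₁ z₂ nothing) _ _ = inj₁ (node-mono (⊑-whole z₁) (⊑-whole z₂) tt)
    between (node z₁ z₂ (just (c , d))) x⊑z _ =
      inj₂ (node-mono (⊑-left x⊑z) (⊑-right x⊑z)
             (⊑-sameBlock (⊑-left x⊑z) (someLeaf a) c (whole-sameBlock (someLeaf a) c) ,
              ⊑-sameBlock (⊑-right x⊑z) d (someLeaf b) (whole-sameBlock d (someLeaf b))))

  Covers-respˡ : ∀ {S} {x x' y : Partition S} → Covers x y → x' ⊑ x → x ⊑ x' → Covers x' y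
  Covers-respˡ (x⊑y , y⋢x , between) x'⊑x x⊑x' =
    ⊑-trans x'⊑x x⊑y , (λ h → y⋢x (⊑-trans h x'⊑x)) ,
    λ z x'⊑z z⊑y → Sum.map₁ (λ k → ⊑-trans k x⊑x') (between z (⊑-trans x⊑x' x'⊑z) z⊑y)

  chain-zero : ∀ S → chain S 0 ⊑ discrete S
  chain-zero (lf i) = ⊑-refl leaf
  chain-zero (nd a b) rewrite chain-left a b 0 z≤n = node-mono (chain-zero a) (⊑-refl (discrete b)) tt

  whole-⊑-chain : ∀ S i → rank S ≤ i → whole S ⊑ chain S i
  whole-⊑-chain (lf x) i _ = ⊑-refl leaf
  whole-⊑-chain (nd a b) i rank≤ with ≤-or-beyond (rank a) i
  ... | inj₁ i≤ = ⊥-elim (1+n≰n (≤-trans (≤-trans (s≤s (m≤m+n (rank a) (rank b))) rank≤) i≤))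
  ... | inj₂ (j , eq) rewrite chain-whole a b i j eq (offset-lower (rank a) (rank b) eq rank≤) = ⊑-refl _

  ChainCovers : Tr n → Set
  ChainCovers S = ∀ i → suc i ≤ rank S → Covers (chain S i) (chain S (suc i))

  chain-covers-node : ∀ a b → ChainCovers a → ChainCovers b → ChainCovers (nd a b)
  chain-covers-node a b covers-a covers-b i i< with ≤-or-beyond (rank a) i
  ... | inj₁ i≤ with m≤n⇒m<n∨m≡n i≤
  ...   | inj₁ i<a rewrite chain-left a b i i≤ | chain-left a b (suc i) i<a = Covers-left (covers-a i i<a)
  chain-covers-node a (lf y) covers-a covers-b i i< | inj₁ i≤ | inj₂ refl
    rewrite chain-left a (lf y) i i≤ | chain-whole a (lf y) (suc (rank a)) 0 (+-comm 1 (rank a)) z≤n =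
    Covers-respˡ (Covers-merge a (lf y)) (node-mono (⊑-whole _) (⊑-refl leaf) tt)
                 (node-mono (whole-⊑-chain a (rank a) ≤-refl) (⊑-refl leaf) tt)
  chain-covers-node a b@(nd _ _) covers-a covers-b i i< | inj₁ i≤ | inj₂ refl
    rewrite chain-left a b i i≤ | chain-right a b (suc (rank a)) 0 (+-comm 1 (rank a)) (s≤s z≤n) =
    Covers-respˡ (Covers-right (covers-b 0 (s≤s z≤n))) (node-mono (⊑-whole _) (discrete-⊑ _) tt)
                 (node-mono (whole-⊑-chain a (rank a) ≤-refl) (chain-zero b) tt)
  chain-covers-node a b covers-a covers-b i i< | inj₂ (j , eq) with suc (suc j) ≤? rank b
  ... | yes j+1< rewrite chain-right a b i j eq (≤-trans (n≤1+n _) j+1<)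
                       | chain-right a b (suc i) (suc j) (suc-offset (rank a) eq) j+1< = Covers-right (covers-b (suc j) j+1<)
  ... | no j+1≮ rewrite chain-right a b i j eq (offset-bound (rank a) (rank b) eq i<)
                      | chain-whole a b (suc i) (suc j) (suc-offset (rank a) eq) (≤-pred (≰⇒> j+1≮)) =
    Covers-respˡ (Covers-merge a b) (node-mono (⊑-refl _) (⊑-whole _) tt)
                 (node-mono (⊑-refl _) (whole-⊑-chain b (suc j) (≤-pred (≰⇒> j+1≮))) tt)

  chain-covers : ∀ S → ChainCovers S
  chain-covers (lf x) i ()
  chain-covers (nd a b) = chain-covers-node a b (chain-covers a) (chain-covers b)

  Atomᵖ : ∀ {S} → Partition S → Set
  Atomᵖ {S} x = ¬ (x ⊑ discrete S) × (∀ z → z ⊑ x → z ⊑ discrete S ⊎ x ⊑ z)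

  AtLevel : ∀ S → Partition S → ℕ → Set
  AtLevel S x ℓ = x ⊑ chain S (suc ℓ) × ¬ (x ⊑ chain S ℓ)

  data Ascending (S : Tr n) : ℕ → List (Partition S) → Set where
    [] : ∀ {ℓ} → Ascending S ℓ []
    next : ∀ {ℓ ℓ' x xs} → ℓ < ℓ' → Atomᵖ x → AtLevel S x ℓ' → Ascending S ℓ' xs → Ascending S ℓ (x ∷ xs)

  LevelConditionᵖ : Tr n → Set
  LevelConditionᵖ S = ∀ (a₀ : Partition S) ℓ₀ as → Atomᵖ a₀ → AtLevel S a₀ ℓ₀ → Ascending S ℓ₀ as →
    ∃[ U ] All (_⊑ U) as × ¬ (a₀ ⊑ U)

  AtLevel-bound : ∀ S x ℓ → AtLevel S x ℓ → ℓ < rank S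
  AtLevel-bound S x ℓ (h₁ , h₂) with suc ℓ ≤? rank S
  ... | yes h = h
  ... | no nh = ⊥-elim (h₂ (⊑-trans (⊑-whole x) (whole-⊑-chain S ℓ (≤-pred (≰⇒> nh)))))

  leftPart : ∀ {a b} → Partition (nd a b) → Partition a
  leftPart (node p q m) = p
  rightPart : ∀ {a b} → Partition (nd a b) → Partition b
  rightPart (node p q m) = q
  mergeOf : ∀ {a b} → Partition (nd a b) → Maybe (Leaf a × Leaf b)
  mergeOf (node p q m) = m

  ⊑-node : ∀ {a b} (x : Partition (nd a b)) {U₁ U₂ m} →
    leftPart x ⊑ U₁ → rightPart x ⊑ U₂ → MergeIn (mergeOf x) (node U₁ U₂ m) → x ⊑ node U₁ U₂ m
  ⊑-node (node p q m) h₁ h₂ h₃ = node-mono h₁ h₂ h₃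

  LevelKind : ∀ (ka kb ℓ : ℕ) → Set
  LevelKind ka kb ℓ = ℓ < ka ⊎ (∃[ j ] ℓ ≡ ka + j × j < kb) ⊎ ℓ ≡ ka + kb

  levelKind : ∀ ka kb ℓ → ℓ < suc (ka + kb) → LevelKind ka kb ℓ
  levelKind ka kb ℓ h with ≤-or-beyond ka ℓ
  ... | inj₁ h₁ with m≤n⇒m<n∨m≡n h₁
  ...   | inj₁ lt = inj₁ lt
  levelKind ka zero ℓ h | inj₁ h₁ | inj₂ refl = inj₂ (inj₂ (sym (+-identityʳ ka)))
  levelKind ka (suc kb) ℓ h | inj₁ h₁ | inj₂ refl = inj₂ (inj₁ (0 , sym (+-identityʳ ka) , s≤s z≤n))
  levelKind ka kb ℓ h | inj₂ (j , eq) with m≤n⇒m<n∨m≡n (offset-bound ka kb eq h)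
  ... | inj₁ lt = inj₂ (inj₁ (suc j , eq , lt))
  ... | inj₂ e = inj₂ (inj₂ (trans eq (cong (ka +_) e)))

  chain-middle : ∀ a b j → j ≤ rank b → node (whole a) (chain b j) nothing ⊑ chain (nd a b) (rank a + j)
  chain-middle a b zero h rewrite chain-left a b (rank a + 0) (≤-reflexive (+-identityʳ (rank a))) =
    node-mono (whole-⊑-chain a (rank a + 0) (m≤m+n (rank a) 0)) (chain-zero b) tt
  chain-middle a b (suc j) h rewrite chain-right a b (rank a + suc j) j refl h = ⊑-refl _

  leftLevelAtom : ∀ a b (x : Partition (nd a b)) ℓ → Atomᵖ x → AtLevel (nd a b) x ℓ → ℓ < rank a →
    Σ[ x₁ ∈ Partition a ] Σ[ x₂ ∈ Partition b ] x ≡ node x₁ x₂ nothing × Atomᵖ x₁ × AtLevel a x₁ ℓ × x₂ ⊑ discrete b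
  leftLevelAtom a b x ℓ (x⋢0 , minimal) (x⊑ , x⋢) lt
    rewrite chain-left a b (suc ℓ) lt with ⊑-unmerged x⊑
  ... | x₁ , x₂ , refl =
    x₁ , x₂ , refl ,
    ((λ h → x⋢0 (node-mono h (⊑-right x⊑) tt)) , atomic₁) ,
    (⊑-left x⊑ , λ h → x⋢ (subst (node x₁ x₂ nothing ⊑_) (sym (chain-left a b ℓ (<⇒≤ lt))) (node-mono h (⊑-right x⊑) tt))) ,
    ⊑-right x⊑
    where
    atomic₁ : ∀ z → z ⊑ x₁ → z ⊑ discrete a ⊎ x₁ ⊑ z
    atomic₁ z h with minimal (node z (discrete b) nothing) (node-mono h (discrete-⊑ x₂) tt)
    ... | inj₁ k = inj₁ (⊑-left k)
    ... | inj₂ k = inj₂ (⊑-left k)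

  rightLevelAtom : ∀ a b (x : Partition (nd a b)) ℓ j → Atomᵖ x → AtLevel (nd a b) x ℓ → ℓ ≡ rank a + j → j < rank b →
    Σ[ x₁ ∈ Partition a ] Σ[ x₂ ∈ Partition b ] x ≡ node x₁ x₂ nothing × x₁ ⊑ discrete a × Atomᵖ x₂ × AtLevel b x₂ j
  rightLevelAtom a b x ℓ j (x⋢0 , minimal) (x⊑ , x⋢) refl lt
    with ⊑-unmerged (subst (x ⊑_) (chain-right a b (suc (rank a + j)) j (sym (+-suc (rank a) j)) lt) x⊑)
  ... | x₁ , x₂ , refl = x₁ , x₂ , refl , x₁⊑0 , (x₂⋢0 , atomic₂) , (⊑-right x⊑' , x₂⋢chain)
    where
    x⊑' : node x₁ x₂ nothing ⊑ node (whole a) (chain b (suc j)) nothing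
    x⊑' = subst (node x₁ x₂ nothing ⊑_) (chain-right a b (suc (rank a + j)) j (sym (+-suc (rank a) j)) lt) x⊑
    x₂⋢chain : ¬ (x₂ ⊑ chain b j)
    x₂⋢chain h = x⋢ (⊑-trans (node-mono (⊑-whole x₁) h tt) (chain-middle a b j (<⇒≤ lt)))
    x₂⋢0 : ¬ (x₂ ⊑ discrete b)
    x₂⋢0 h = x₂⋢chain (⊑-trans h (discrete-⊑ _))
    x₁⊑0 : x₁ ⊑ discrete a
    x₁⊑0 with minimal (node (discrete a) x₂ nothing) (node-mono (discrete-⊑ x₁) (⊑-refl x₂) tt)
    ... | inj₁ k = ⊥-elim (x₂⋢0 (⊑-right k))
    ... | inj₂ k = ⊑-left k
    atomic₂ : ∀ z → z ⊑ x₂ → z ⊑ discrete b ⊎ x₂ ⊑ z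
    atomic₂ z h with minimal (node (discrete a) z nothing) (node-mono (discrete-⊑ x₁) h tt)
    ... | inj₁ k = inj₁ (⊑-right k)
    ... | inj₂ k = inj₂ (⊑-right k)

  mergeLevelAtom : ∀ a b (x : Partition (nd a b)) ℓ → Atomᵖ x → AtLevel (nd a b) x ℓ → ℓ ≡ rank a + rank b →
    Σ[ x₁ ∈ Partition a ] Σ[ x₂ ∈ Partition b ] Σ[ cd ∈ Leaf a × Leaf b ]
      x ≡ node x₁ x₂ (just cd) × x₁ ⊑ discrete a × x₂ ⊑ discrete b
  mergeLevelAtom a b (node x₁ x₂ nothing) ℓ (x⋢0 , minimal) (x⊑ , x⋢) refl =
    ⊥-elim (x⋢ (⊑-trans (node-mono (⊑-whole x₁) (⊑-trans (⊑-whole x₂) (whole-⊑-chain b (rank b) ≤-refl)) tt)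
                        (chain-middle a b (rank b) ≤-refl)))
  mergeLevelAtom a b (node x₁ x₂ (just cd)) ℓ (x⋢0 , minimal) (x⊑ , x⋢) refl
    with minimal (node x₁ x₂ nothing) (node-mono (⊑-refl x₁) (⊑-refl x₂) tt)
  ... | inj₁ k = x₁ , x₂ , cd , refl , ⊑-left k , ⊑-right k
  ... | inj₂ k = ⊥-elim (⊑-merge k)

  -- Only the last atom of an ascending list can merge at the root.
  firstMerge : ∀ {a b} → List (Partition (nd a b)) → Maybe (Leaf a × Leaf b)
  firstMerge [] = nothing
  firstMerge (node _ _ (just cd) ∷ xs) = just cd
  firstMerge (node _ _ nothing ∷ xs) = firstMerge xs

  chain-unmerged : ∀ a b i → i ≤ rank a + rank b →
    Σ[ u₁ ∈ Partition a ] Σ[ u₂ ∈ Partition b ] chain (nd a b) i ≡ node u₁ u₂ nothing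
  chain-unmerged a b i h with ≤-or-beyond (rank a) i
  ... | inj₁ h₁ = _ , _ , chain-left a b i h₁
  ... | inj₂ (j , eq) = _ , _ , chain-right a b i j eq (+-cancelˡ-≤ (rank a) _ _ (subst (_≤ rank a + rank b) eq h))

  merged-lastLevel : ∀ a b x₁ x₂ cd ℓ → AtLevel (nd a b) (node x₁ x₂ (just cd)) ℓ → rank a + rank b ≤ ℓ
  merged-lastLevel a b x₁ x₂ cd ℓ (lv₁ , lv₂) with rank a + rank b ≤? ℓ
  ... | yes h = h
  ... | no nh with chain-unmerged a b (suc ℓ) (≰⇒> nh)
  ...   | u₁ , u₂ , eq = ⊥-elim (⊑-merge (subst (node x₁ x₂ (just cd) ⊑_) eq lv₁))

  Ascending-afterLast : ∀ a b ℓ xs → rank a + rank b ≤ ℓ → Ascending (nd a b) ℓ xs → xs ≡ []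
  Ascending-afterLast a b ℓ [] h inc = refl
  Ascending-afterLast a b ℓ (x ∷ xs) h (next {ℓ' = ℓ'} lt at lev inc) =
    ⊥-elim (<⇒≱ (≤-<-trans h lt) (≤-pred (AtLevel-bound (nd a b) x ℓ' lev)))

  firstMerge-in : ∀ a b ℓ as → Ascending (nd a b) ℓ as → ∀ U₁ U₂ →
    All (λ x → MergeIn (mergeOf x) (node U₁ U₂ (firstMerge as))) as
  firstMerge-in a b ℓ [] [] U₁ U₂ = []
  firstMerge-in a b ℓ (node x₁ x₂ nothing ∷ xs) (next lt at lev inc) U₁ U₂ = tt ∷ firstMerge-in a b _ xs inc U₁ U₂
  firstMerge-in a b ℓ (node x₁ x₂ (just (c , d)) ∷ xs) (next {ℓ' = ℓ'} lt at lev inc) U₁ U₂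
    with Ascending-afterLast a b ℓ' xs (merged-lastLevel a b x₁ x₂ (c , d) ℓ' lev) inc
  ... | refl = (SameBlock-refl U₁ c , SameBlock-refl U₂ d) ∷ []

  leftPart-discrete : ∀ a b x ℓ → Atomᵖ x → AtLevel (nd a b) x ℓ → rank a ≤ ℓ → leftPart x ⊑ discrete a
  leftPart-discrete a b x ℓ at lev h with levelKind (rank a) (rank b) ℓ (AtLevel-bound (nd a b) x ℓ lev)
  ... | inj₁ lt = ⊥-elim (<⇒≱ lt h)
  ... | inj₂ (inj₁ (j , eq , lt)) with rightLevelAtom a b x ℓ j at lev eq lt
  ...   | x₁ , x₂ , refl , k , _ = k
  leftPart-discrete a b x ℓ at lev h | inj₂ (inj₂ eq) with mergeLevelAtom a b x ℓ at lev eq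
  ...   | x₁ , x₂ , cd , refl , k , _ = k

  rightPart-discrete : ∀ a b x ℓ → Atomᵖ x → AtLevel (nd a b) x ℓ → rank a + rank b ≤ ℓ → rightPart x ⊑ discrete b
  rightPart-discrete a b x ℓ at lev h with levelKind (rank a) (rank b) ℓ (AtLevel-bound (nd a b) x ℓ lev)
  ... | inj₁ lt = ⊥-elim (<⇒≱ lt (≤-trans (m≤m+n (rank a) (rank b)) h))
  ... | inj₂ (inj₁ (j , eq , lt)) = ⊥-elim (<⇒≱ (subst (_< rank a + rank b) (sym eq) (+-monoʳ-< (rank a) lt)) h)
  ... | inj₂ (inj₂ eq) with mergeLevelAtom a b x ℓ at lev eq
  ...   | x₁ , x₂ , cd , refl , _ , k = k

  All-leftPart-discrete : ∀ a b ℓ as → rank a ≤ ℓ → Ascending (nd a b) ℓ as → All (λ x → leftPart x ⊑ discrete a) as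
  All-leftPart-discrete a b ℓ [] h [] = []
  All-leftPart-discrete a b ℓ (x ∷ xs) h (next {ℓ' = ℓ'} lt at lev inc) =
    leftPart-discrete a b x ℓ' at lev h' ∷ All-leftPart-discrete a b ℓ' xs h' inc
    where
    h' = ≤-trans h (<⇒≤ lt)

  projectLeft : ∀ a b ℓ as → ℓ < rank a → Ascending (nd a b) ℓ as →
    Σ[ as₁ ∈ List (Partition a) ] Ascending a ℓ as₁ × (∀ U₁ → All (_⊑ U₁) as₁ → All (λ x → leftPart x ⊑ U₁) as)
  projectLeft a b ℓ [] h [] = [] , [] , (λ U₁ _ → [])
  projectLeft a b ℓ (x ∷ xs) h (next {ℓ' = ℓ'} lt at lev inc) with ≤-<-connex (suc ℓ') (rank a)
  ... | inj₁ lt' with leftLevelAtom a b x ℓ' at lev lt' | projectLeft a b ℓ' xs lt' inc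
  ...   | x₁ , x₂ , refl , atom₁ , lev₁ , _ | as₁ , inc₁ , f =
    x₁ ∷ as₁ , next lt atom₁ lev₁ inc₁ , λ { U₁ (k ∷ ks) → k ∷ f U₁ ks }
  projectLeft a b ℓ (x ∷ xs) h (next {ℓ' = ℓ'} lt at lev inc) | inj₂ a<ℓ'+1 =
    [] , [] , λ U₁ _ →
      ⊑-trans (leftPart-discrete a b x ℓ' at lev h') (discrete-⊑ U₁) ∷
      All.map (λ k → ⊑-trans k (discrete-⊑ U₁)) (All-leftPart-discrete a b ℓ' xs h' inc)
    where
    h' = ≤-pred a<ℓ'+1

  projectRight : ∀ a b ℓ as j → ℓ ≡ rank a + j → j < rank b → Ascending (nd a b) ℓ as →
    Σ[ as₂ ∈ List (Partition b) ] Ascending b j as₂ × (∀ U₂ → All (_⊑ U₂) as₂ → All (λ x → rightPart x ⊑ U₂) as)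
  projectRight a b ℓ [] j eq h [] = [] , [] , (λ U₂ _ → [])
  projectRight a b ℓ (x ∷ xs) j eq h (next {ℓ' = ℓ'} lt at lev inc) with levelKind (rank a) (rank b) ℓ' (AtLevel-bound (nd a b) x ℓ' lev)
  ... | inj₁ lt' = ⊥-elim (<⇒≱ (<-trans lt lt') (subst (rank a ≤_) (sym eq) (m≤m+n (rank a) j)))
  ... | inj₂ (inj₁ (j' , eq' , lt')) with rightLevelAtom a b x ℓ' j' at lev eq' lt' | projectRight a b ℓ' xs j' eq' lt' inc
  ...   | x₁ , x₂ , refl , _ , atom₂ , lev₂ | as₂ , inc₂ , g =
    x₂ ∷ as₂ , next (+-cancelˡ-< (rank a) j j' (subst₂ _<_ eq eq' lt)) atom₂ lev₂ inc₂ , λ { U₂ (k ∷ ks) → k ∷ g U₂ ks }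
  projectRight a b ℓ (x ∷ xs) j eq h (next {ℓ' = ℓ'} lt at lev inc) | inj₂ (inj₂ eq')
    with Ascending-afterLast a b ℓ' xs (≤-reflexive (sym eq')) inc
  ... | refl = [] , [] , λ U₂ _ →
    ⊑-trans (rightPart-discrete a b x ℓ' at lev (≤-reflexive (sym eq'))) (discrete-⊑ U₂) ∷ []

  All-⊑-node : ∀ {a b} (as : List (Partition (nd a b))) U₁ U₂ m →
    All (λ x → leftPart x ⊑ U₁) as → All (λ x → rightPart x ⊑ U₂) as → All (λ x → MergeIn (mergeOf x) (node U₁ U₂ m)) as →
    All (_⊑ node U₁ U₂ m) as
  All-⊑-node [] U₁ U₂ m [] [] [] = []
  All-⊑-node (x ∷ xs) U₁ U₂ m (h₁ ∷ hs₁) (h₂ ∷ hs₂) (h₃ ∷ hs₃) =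
    ⊑-node x h₁ h₂ h₃ ∷ All-⊑-node xs U₁ U₂ m hs₁ hs₂ hs₃

  levelConditionᵖ-node : ∀ a b → LevelConditionᵖ a → LevelConditionᵖ b → LevelConditionᵖ (nd a b)
  levelConditionᵖ-node a b lc-a lc-b a₀ ℓ₀ as atom₀ lev₀ asc
    with levelKind (rank a) (rank b) ℓ₀ (AtLevel-bound (nd a b) a₀ ℓ₀ lev₀)
  ... | inj₁ ℓ₀<a with leftLevelAtom a b a₀ ℓ₀ atom₀ lev₀ ℓ₀<a | projectLeft a b ℓ₀ as ℓ₀<a asc
  ...   | a₀ˡ , _ , refl , atomˡ , levˡ , _ | asˡ , ascˡ , lift with lc-a a₀ˡ ℓ₀ asˡ atomˡ levˡ ascˡ
  ...     | U , asˡ⊑U , a₀ˡ⋢U =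
    node U (whole b) (firstMerge as) ,
    All-⊑-node as U (whole b) (firstMerge as) (lift U asˡ⊑U) (All.tabulate (λ {x} _ → ⊑-whole (rightPart x)))
               (firstMerge-in a b ℓ₀ as asc U (whole b)) ,
    λ h → a₀ˡ⋢U (⊑-left h)
  levelConditionᵖ-node a b lc-a lc-b a₀ ℓ₀ as atom₀ lev₀ asc | inj₂ (inj₁ (j , eq , j<b))
    with rightLevelAtom a b a₀ ℓ₀ j atom₀ lev₀ eq j<b | projectRight a b ℓ₀ as j eq j<b asc
  ... | _ , a₀ʳ , refl , _ , atomʳ , levʳ | asʳ , ascʳ , lift with lc-b a₀ʳ j asʳ atomʳ levʳ ascʳ
  ...   | U , asʳ⊑U , a₀ʳ⋢U =
    node (whole a) U (firstMerge as) ,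
    All-⊑-node as (whole a) U (firstMerge as) (All.tabulate (λ {x} _ → ⊑-whole (leftPart x))) (lift U asʳ⊑U)
               (firstMerge-in a b ℓ₀ as asc (whole a) U) ,
    λ h → a₀ʳ⋢U (⊑-right h)
  levelConditionᵖ-node a b lc-a lc-b a₀ ℓ₀ as atom₀ lev₀ asc | inj₂ (inj₂ eq)
    with mergeLevelAtom a b a₀ ℓ₀ atom₀ lev₀ eq | Ascending-afterLast a b ℓ₀ as (≤-reflexive (sym eq)) asc
  ... | _ , _ , _ , refl , _ , _ | refl = node (whole a) (whole b) nothing , [] , ⊑-merge

  levelConditionᵖ : ∀ S → LevelConditionᵖ S
  levelConditionᵖ (lf i) leaf ℓ₀ as (leaf⋢0 , _) lev asc = ⊥-elim (leaf⋢0 (⊑-refl leaf))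
  levelConditionᵖ (nd a b) = levelConditionᵖ-node a b (levelConditionᵖ a) (levelConditionᵖ b)

  allLeaves : ∀ S → List (Leaf S)
  allLeaves (lf i) = tt ∷ []
  allLeaves (nd a b) = map inj₁ (allLeaves a) ++ map inj₂ (allLeaves b)

  ∈-allLeaves : ∀ S (x : Leaf S) → x ∈ allLeaves S
  ∈-allLeaves (lf i) tt = here refl
  ∈-allLeaves (nd a b) (inj₁ x) = ∈-++⁺ˡ (∈-map⁺ inj₁ (∈-allLeaves a x))
  ∈-allLeaves (nd a b) (inj₂ x) = ∈-++⁺ʳ (map inj₁ (allLeaves a)) (∈-map⁺ inj₂ (∈-allLeaves b x))

  allMerges : ∀ a b → List (Maybe (Leaf a × Leaf b))
  allMerges a b = nothing ∷ map just (cartesianProduct (allLeaves a) (allLeaves b))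

  ∈-allMerges : ∀ a b (m : Maybe (Leaf a × Leaf b)) → m ∈ allMerges a b
  ∈-allMerges a b nothing = here refl
  ∈-allMerges a b (just (x , y)) = there (∈-map⁺ just (∈-cartesianProduct⁺ (∈-allLeaves a x) (∈-allLeaves b y)))

  uncurriedNode : ∀ {a b} → Partition a × Partition b → Maybe (Leaf a × Leaf b) → Partition (nd a b)
  uncurriedNode (p , q) m = node p q m

  allPartitions : ∀ S → List (Partition S)
  allPartitions (lf i) = leaf ∷ []
  allPartitions (nd a b) =
    cartesianProductWith uncurriedNode (cartesianProduct (allPartitions a) (allPartitions b)) (allMerges a b)

  ∈-allPartitions : ∀ S (x : Partition S) → x ∈ allPartitions S
  ∈-allPartitions (lf i) leaf = here refl
  ∈-allPartitions (nd a b) (node p q m) =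
    ∈-cartesianProductWith⁺ uncurriedNode (∈-cartesianProduct⁺ (∈-allPartitions a p) (∈-allPartitions b q)) (∈-allMerges a b m)

  module _ (S : Tr n) where
    open LatticeNotions (Partition S) _⊑_ hiding (_<_)

    Partition-isFinite : IsFinite
    Partition-isFinite = allPartitions S , λ x → Any.map (λ { refl → ⊑-refl x , ⊑-refl x }) (∈-allPartitions S x)

    Partition-isLattice : IsLattice
    Partition-isLattice =
      (λ x y → x ⊔ y , (⊔-upperˡ x y ∷ ⊔-upperʳ x y ∷ []) , λ { u (x⊑u ∷ y⊑u ∷ []) → ⊔-least x y u x⊑u y⊑u }) ,
      (λ x y → x ⊓ y , ⊓-lowerˡ x y , ⊓-lowerʳ x y , λ u u⊑x u⊑y → ⊓-greatest u⊑x u⊑y)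

    chainᶠ : Fin (suc (rank S)) → Partition S
    chainᶠ i = chain S (toℕ i)

    Covers⇒⋖ : ∀ {x y} → Covers x y → x ⋖ y
    Covers⇒⋖ (x⊑y , y⋢x , between) =
      (x⊑y , y⋢x) , λ z (x⊑z , z⋢x) (z⊑y , y⋢z) → Sum.[ z⋢x , y⋢z ] (between z x⊑z z⊑y)

    chainᶠ-isMaximalChain : IsMaximalChain (rank S) chainᶠ
    chainᶠ-isMaximalChain =
      (λ x → ⊑-trans (chain-zero S) (discrete-⊑ x)) ,
      (λ x → subst (λ t → x ⊑ chain S t) (sym (toℕ-fromℕ (rank S))) (⊑-trans (⊑-whole x) (whole-⊑-chain S (rank S) ≤-refl))) ,
      λ i → subst (λ t → chain S t ⋖ chain S (suc (toℕ i))) (sym (toℕ-inject₁ i)) (Covers⇒⋖ (chain-covers S (toℕ i) (toℕ<n i)))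

    LeftModularᵖ⇒LeftModular : ∀ {x} → LeftModularᵖ x → LeftModular x
    LeftModularᵖ⇒LeftModular {x} lm y z y⊑z m (m⊑x , m⊑z , m-greatest) j ((y⊑j ∷ m⊑j ∷ []) , j-least)
                               j' ((y⊑j' ∷ x⊑j' ∷ []) , j'-least) m' (m'⊑j' , m'⊑z , m'-greatest) =
      j-least m' (m'-greatest y y⊑j' y⊑z ∷ m'-greatest m (⊑-trans m⊑x x⊑j') m⊑z ∷ []) ,
      ⊑-trans (⊓-greatest (⊑-trans m'⊑j' (j'-least (y ⊔ x) (⊔-upperˡ y x ∷ ⊔-upperʳ y x ∷ []))) m'⊑z)
        (⊑-trans (lm y z y⊑z)
          (⊔-least y (x ⊓ z) j y⊑j (⊑-trans (m-greatest (x ⊓ z) (⊓-lowerˡ x z) (⊓-lowerʳ x z)) m⊑j)))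

    chain-step : ∀ i → chain S i ⊑ chain S (suc i)
    chain-step i with suc i ≤? rank S
    ... | yes i< = proj₁ (chain-covers S i i<)
    ... | no i≮ = ⊑-trans (⊑-whole _) (whole-⊑-chain S (suc i) (≤-trans (n≤1+n _) (≰⇒> i≮)))

    chain-mono : ∀ i j → i ≤ j → chain S i ⊑ chain S j
    chain-mono i zero z≤n = ⊑-refl _
    chain-mono i (suc j) i≤ with m≤n⇒m<n∨m≡n i≤
    ... | inj₁ (s≤s i≤j) = ⊑-trans (chain-mono i j i≤j) (chain-step j)
    ... | inj₂ refl = ⊑-refl _

    AtLevel-unique : ∀ x ℓ ℓ' → AtLevel S x ℓ → AtLevel S x ℓ' → ℓ ≡ ℓ'
    AtLevel-unique x ℓ ℓ' (x⊑ , x⋢) (x⊑' , x⋢') with <-cmp ℓ ℓ'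
    ... | tri< ℓ<ℓ' _ _ = ⊥-elim (x⋢' (⊑-trans x⊑ (chain-mono (suc ℓ) ℓ' ℓ<ℓ')))
    ... | tri≈ _ ℓ≡ℓ' _ = ℓ≡ℓ'
    ... | tri> _ _ ℓ'<ℓ = ⊥-elim (x⋢ (⊑-trans x⊑' (chain-mono (suc ℓ') ℓ ℓ'<ℓ)))

    IsAtom⇒Atomᵖ : ∀ {a} → IsAtom a → Atomᵖ a
    IsAtom⇒Atomᵖ {a} (b , b-bottom , (b⊑a , a⋢b) , nothing-between) = (λ h → a⋢b (⊑-trans h (discrete-⊑ b))) , below
      where
      below : ∀ z → z ⊑ a → z ⊑ discrete S ⊎ a ⊑ z
      below z z⊑a with z ⊑? discrete S | a ⊑? z
      ... | yes z⊑0 | _ = inj₁ z⊑0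
      ... | no _ | yes a⊑z = inj₂ a⊑z
      ... | no z⋢0 | no a⋢z =
        ⊥-elim (nothing-between z (b-bottom z , λ z⊑b → z⋢0 (⊑-trans z⊑b (b-bottom (discrete S)))) (z⊑a , a⋢z))

    InLevel⇒AtLevel : ∀ {a i} → InLevel chainᶠ a i → AtLevel S a (toℕ i)
    InLevel⇒AtLevel {a} {i} (_ , a⊑ , a⋢) = a⊑ , λ h → a⋢ (subst (λ t → a ⊑ chain S t) (sym (toℕ-inject₁ i)) h)

    Linked⇒Ascending : ∀ a₀ ℓ₀ as → AtLevel S a₀ ℓ₀ → All IsAtom as → Linked (_◁_ chainᶠ) (a₀ ∷ as) →
      Ascending S ℓ₀ as
    Linked⇒Ascending a₀ ℓ₀ [] _ _ _ = []
    Linked⇒Ascending a₀ ℓ₀ (a₁ ∷ as) lev₀ (atom₁ ∷ atoms) ((i , j , i<j , l₀ , l₁) ∷ linked) =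
      next (subst (_< toℕ j) (sym (AtLevel-unique a₀ ℓ₀ (toℕ i) lev₀ (InLevel⇒AtLevel l₀))) i<j)
           (IsAtom⇒Atomᵖ atom₁) (InLevel⇒AtLevel l₁) (Linked⇒Ascending a₁ (toℕ j) as (InLevel⇒AtLevel l₁) atoms linked)

    chainᶠ-levelCondition : LevelCondition chainᶠ
    chainᶠ-levelCondition a₀ [] (atom₀ ∷ _) _ j (_ , least) a₀⊑j =
      proj₁ (IsAtom⇒Atomᵖ atom₀) (⊑-trans a₀⊑j (least (discrete S) []))
    chainᶠ-levelCondition a₀ as@(_ ∷ _) (atom₀ ∷ atoms) linked@((i , _ , _ , l₀ , _) ∷ _) j (_ , least) a₀⊑j
      with levelConditionᵖ S a₀ (toℕ i) as (IsAtom⇒Atomᵖ atom₀) (InLevel⇒AtLevel l₀)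
             (Linked⇒Ascending a₀ (toℕ i) as (InLevel⇒AtLevel l₀) atoms linked)
    ... | U , as⊑U , a₀⋢U = a₀⋢U (⊑-trans a₀⊑j (least U as⊑U))

  Partition-isLLLattice : ∀ S → IsLLLattice (Partition S) _⊑_
  Partition-isLLLattice S =
    Partition-isFinite S , Partition-isLattice S , rank S , chainᶠ S , chainᶠ-isMaximalChain S ,
    (λ i → LeftModularᵖ⇒LeftModular S (chain-leftModular S (toℕ i))) , chainᶠ-levelCondition S

-- Equivalence relations on the leaves as partitions

module _ {n : ℕ} where

  Represents : ∀ {S : Tr n} → Partition S → Rel (Leaf S) 0ℓ → Set
  Represents p Q = ∀ x y → (SameBlock p x y → Q x y) × (Q x y → SameBlock p x y)

  Compatible : ∀ (S : Tr n) → Rel (Leaf S) 0ℓ → Set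
  Compatible (lf i) Q = ⊤
  Compatible (nd a b) Q = Compatible a (Q on inj₁) × Compatible b (Q on inj₂) ×
    (∀ x x' y y' → Q (inj₁ x) (inj₂ y) → Q (inj₁ x') (inj₂ y') → Q (inj₁ x) (inj₁ x'))

  Crossing : ∀ {a b : Tr n} → Rel (Leaf (nd a b)) 0ℓ → Set
  Crossing {a} {b} Q = ∃₂ λ (x : Leaf a) (y : Leaf b) → Q (inj₁ x) (inj₂ y)

  crossing? : ∀ a b {Q : Rel (Leaf (nd a b)) 0ℓ} → IsDecEquivalence Q → Dec (Crossing Q)
  crossing? a b Q-eq = search a (λ x → search b (λ y → IsDecEquivalence._≟_ Q-eq (inj₁ x) (inj₂ y)))

  encode : ∀ S (Q : Rel (Leaf S) 0ℓ) → IsDecEquivalence Q → Partition S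
  encode (lf i) Q _ = leaf
  encode (nd a b) Q Q-eq =
    node (encode a (Q on inj₁) (On.isDecEquivalence inj₁ Q-eq)) (encode b (Q on inj₂) (On.isDecEquivalence inj₂ Q-eq))
         (witnessPair (crossing? a b Q-eq))

  encode-crossing : ∀ {a b} {Q : Rel (Leaf (nd a b)) 0ℓ} (Q-eq : IsDecEquivalence Q) {p : Partition a} {q : Partition b} →
    Represents p (Q on inj₁) → Represents q (Q on inj₂) →
    (∀ x x' y y' → Q (inj₁ x) (inj₂ y) → Q (inj₁ x') (inj₂ y') → Q (inj₁ x) (inj₁ x')) →
    (s : Dec (Crossing Q)) → ∀ x y →
    (SameBlock (node p q (witnessPair s)) (inj₁ x) (inj₂ y) → Q (inj₁ x) (inj₂ y)) ×
    (Q (inj₁ x) (inj₂ y) → SameBlock (node p q (witnessPair s)) (inj₁ x) (inj₂ y))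
  encode-crossing Q-eq rep-p rep-q compatible (yes (c , d , Qcd)) x y =
    (λ (xc , dy) → Q.trans (proj₁ (rep-p x c) xc) (Q.trans Qcd (proj₁ (rep-q d y) dy))) ,
    λ Qxy → proj₂ (rep-p x c) (compatible x c y d Qxy Qcd) ,
            proj₂ (rep-q d y) (Q.trans (Q.sym Qcd) (Q.trans (compatible c x d y Qcd Qxy) Qxy))
    where module Q = IsDecEquivalence Q-eq
  encode-crossing Q-eq rep-p rep-q compatible (no ¬crossing) x y = (λ ()) , λ Qxy → ¬crossing (x , y , Qxy)

  encode-represents : ∀ S {Q : Rel (Leaf S) 0ℓ} (Q-eq : IsDecEquivalence Q) → Compatible S Q → Represents (encode S Q Q-eq) Q
  encode-represents (lf i) Q-eq _ tt tt = (λ _ → IsDecEquivalence.refl Q-eq) , (λ _ → tt)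
  encode-represents (nd a b) {Q} Q-eq (compatible-a , compatible-b , compatible) = represents
    where
    module Q = IsDecEquivalence Q-eq
    rep-a = encode-represents a (On.isDecEquivalence inj₁ Q-eq) compatible-a
    rep-b = encode-represents b (On.isDecEquivalence inj₂ Q-eq) compatible-b
    crossing = encode-crossing Q-eq rep-a rep-b compatible (crossing? a b Q-eq)
    represents : Represents (encode (nd a b) Q Q-eq) Q
    represents (inj₁ x) (inj₁ y) = rep-a x y
    represents (inj₂ x) (inj₂ y) = rep-b x y
    represents (inj₁ x) (inj₂ y) = crossing x y
    represents (inj₂ y) (inj₁ x) =
      (λ r → Q.sym (proj₁ (crossing x y) (SameBlock-sym (encode (nd a b) Q Q-eq) (inj₂ y) (inj₁ x) r))) ,
      (λ q → SameBlock-sym (encode (nd a b) Q Q-eq) (inj₁ x) (inj₂ y) (proj₂ (crossing x y) (Q.sym q)))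

-- Vertices of trees and embeddings of trees

module _ {n : ℕ} where

  Below : ∀ {t : Tr n} → Node t → Node t → Set
  Below {lf i} atLf atLf = ⊤
  Below {nd l r} u atNd = ⊤
  Below {nd l r} (inL u) (inL w) = Below u w
  Below {nd l r} (inR u) (inR w) = Below u w
  Below {nd l r} atNd (inL w) = ⊥
  Below {nd l r} atNd (inR w) = ⊥
  Below {nd l r} (inL u) (inR w) = ⊥
  Below {nd l r} (inR u) (inL w) = ⊥

  Below-refl : ∀ {t : Tr n} (u : Node t) → Below u u
  Below-refl atLf = tt
  Below-refl atNd = tt
  Below-refl (inL u) = Below-refl u
  Below-refl (inR u) = Below-refl u

  Below-trans : ∀ {t : Tr n} (u v w : Node t) → Below u v → Below v w → Below u w
  Below-trans atLf atLf atLf _ _ = tt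
  Below-trans u v atNd _ _ = tt
  Below-trans (inL u) (inL v) (inL w) h k = Below-trans u v w h k
  Below-trans (inR u) (inR v) (inR w) h k = Below-trans u v w h k
  Below-trans atNd atNd (inL w) h ()
  Below-trans atNd atNd (inR w) h ()
  Below-trans (inL u) atNd (inL w) h ()
  Below-trans (inL u) atNd (inR w) h ()
  Below-trans (inR u) atNd (inL w) h ()
  Below-trans (inR u) atNd (inR w) h ()

  Below-top : ∀ {t : Tr n} (u : Node t) → Below u (topNode t)
  Below-top atLf = tt
  Below-top atNd = tt
  Below-top (inL u) = tt
  Below-top (inR u) = tt

  LeftBelow⇒Below : ∀ {t : Tr n} {u w : Node t} → LeftBelow u w → Below u w
  LeftBelow⇒Below lb-here = tt
  LeftBelow⇒Below (lb-L h) = LeftBelow⇒Below h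
  LeftBelow⇒Below (lb-R h) = LeftBelow⇒Below h

  RightBelow⇒Below : ∀ {t : Tr n} {u w : Node t} → RightBelow u w → Below u w
  RightBelow⇒Below rb-here = tt
  RightBelow⇒Below (rb-L h) = RightBelow⇒Below h
  RightBelow⇒Below (rb-R h) = RightBelow⇒Below h

  Below-LeftBelow : ∀ {t : Tr n} (u : Node t) {v w : Node t} → Below u v → LeftBelow v w → LeftBelow u w
  Below-LeftBelow (inL u) h lb-here = lb-here
  Below-LeftBelow atNd {inL v} () lb-here
  Below-LeftBelow (inR u) {inL v} () lb-here
  Below-LeftBelow (inL u) {inL v} h (lb-L k) = lb-L (Below-LeftBelow u h k)
  Below-LeftBelow atNd {inL v} () (lb-L k)
  Below-LeftBelow (inR u) {inL v} () (lb-L k)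
  Below-LeftBelow (inR u) {inR v} h (lb-R k) = lb-R (Below-LeftBelow u h k)
  Below-LeftBelow atNd {inR v} () (lb-R k)
  Below-LeftBelow (inL u) {inR v} () (lb-R k)

  Below-RightBelow : ∀ {t : Tr n} (u : Node t) {v w : Node t} → Below u v → RightBelow v w → RightBelow u w
  Below-RightBelow (inR u) h rb-here = rb-here
  Below-RightBelow atNd {inR v} () rb-here
  Below-RightBelow (inL u) {inR v} () rb-here
  Below-RightBelow (inL u) {inL v} h (rb-L k) = rb-L (Below-RightBelow u h k)
  Below-RightBelow atNd {inL v} () (rb-L k)
  Below-RightBelow (inR u) {inL v} () (rb-L k)
  Below-RightBelow (inR u) {inR v} h (rb-R k) = rb-R (Below-RightBelow u h k)
  Below-RightBelow atNd {inR v} () (rb-R k)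
  Below-RightBelow (inL u) {inR v} () (rb-R k)

  LeftBelow-RightBelow-disjoint : ∀ {t : Tr n} {u w : Node t} → LeftBelow u w → RightBelow u w → ⊥
  LeftBelow-RightBelow-disjoint (lb-L h) (rb-L k) = LeftBelow-RightBelow-disjoint h k
  LeftBelow-RightBelow-disjoint (lb-R h) (rb-R k) = LeftBelow-RightBelow-disjoint h k

  SplitAt : ∀ {t : Tr n} → Node t → Node t → Node t → Set
  SplitAt a b w = (LeftBelow a w × RightBelow b w) ⊎ (RightBelow a w × LeftBelow b w)

  SplitAt⇒¬Below : ∀ {t : Tr n} {a b w : Node t} → SplitAt a b w → ¬ Below a b
  SplitAt⇒¬Below {a = a} (inj₁ (l , r)) h = LeftBelow-RightBelow-disjoint l (Below-RightBelow a h r)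
  SplitAt⇒¬Below {a = a} (inj₂ (r , l)) h = LeftBelow-RightBelow-disjoint (Below-LeftBelow a h l) r

  SplitAt-sym : ∀ {t : Tr n} {a b w : Node t} → SplitAt a b w → SplitAt b a w
  SplitAt-sym (inj₁ (l , r)) = inj₂ (r , l)
  SplitAt-sym (inj₂ (r , l)) = inj₁ (l , r)

  Below-SplitAt : ∀ {t : Tr n} {a b a' b' w : Node t} → SplitAt a b w → Below a' a → Below b' b → SplitAt a' b' w
  Below-SplitAt {a' = a'} {b'} (inj₁ (l , r)) h k = inj₁ (Below-LeftBelow a' h l , Below-RightBelow b' k r)
  Below-SplitAt {a' = a'} {b'} (inj₂ (r , l)) h k = inj₂ (Below-RightBelow a' h r , Below-LeftBelow b' k l)

  SplitAt-unique′ : ∀ {t : Tr n} {a b w w' : Node t} → LeftBelow a w → RightBelow b w → SplitAt a b w' → w ≡ w'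
  SplitAt-unique′ lb-here rb-here (inj₁ (lb-here , rb-here)) = refl
  SplitAt-unique′ lb-here rb-here (inj₁ (lb-L _ , ()))
  SplitAt-unique′ lb-here rb-here (inj₂ (rb-L _ , ()))
  SplitAt-unique′ (lb-L h) (rb-L k) (inj₁ (lb-L h' , rb-L k')) = cong inL (SplitAt-unique′ h k (inj₁ (h' , k')))
  SplitAt-unique′ (lb-L h) (rb-L k) (inj₂ (rb-L h' , lb-L k')) = cong inL (SplitAt-unique′ h k (inj₂ (h' , k')))
  SplitAt-unique′ (lb-R h) (rb-R k) (inj₁ (lb-R h' , rb-R k')) = cong inR (SplitAt-unique′ h k (inj₁ (h' , k')))
  SplitAt-unique′ (lb-R h) (rb-R k) (inj₂ (rb-R h' , lb-R k')) = cong inR (SplitAt-unique′ h k (inj₂ (h' , k')))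
  SplitAt-unique′ (lb-L h) (rb-L k) (inj₁ (lb-here , ()))
  SplitAt-unique′ (lb-R h) (rb-R k) (inj₂ (rb-here , ()))

  SplitAt-unique : ∀ {t : Tr n} {a b w w' : Node t} → SplitAt a b w → SplitAt a b w' → w ≡ w'
  SplitAt-unique (inj₁ (l , r)) s = SplitAt-unique′ l r s
  SplitAt-unique (inj₂ (r , l)) s = SplitAt-unique′ l r (SplitAt-sym s)

  LeftBelow-inner : ∀ {t : Tr n} {u w : Node t} → LeftBelow u w → labelOf w ≡ nothing
  LeftBelow-inner lb-here = refl
  LeftBelow-inner (lb-L h) = LeftBelow-inner h
  LeftBelow-inner (lb-R h) = LeftBelow-inner h

  RightBelow-inner : ∀ {t : Tr n} {u w : Node t} → RightBelow u w → labelOf w ≡ nothing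
  RightBelow-inner rb-here = refl
  RightBelow-inner (rb-L h) = RightBelow-inner h
  RightBelow-inner (rb-R h) = RightBelow-inner h

  SplitAt-inner : ∀ {t : Tr n} {a b w : Node t} → SplitAt a b w → labelOf w ≡ nothing
  SplitAt-inner (inj₁ (l , _)) = LeftBelow-inner l
  SplitAt-inner (inj₂ (r , _)) = RightBelow-inner r

  lca : ∀ {t : Tr n} → Node t → Node t → Node t
  lca atLf atLf = atLf
  lca (inL a) (inL b) = inL (lca a b)
  lca (inR a) (inR b) = inR (lca a b)
  lca {nd l r} _ _ = atNd

  lca-SplitAt : ∀ {t : Tr n} (a b : Node t) → ¬ Below a b → ¬ Below b a → SplitAt a b (lca a b)
  lca-SplitAt atLf atLf h k = ⊥-elim (h tt)
  lca-SplitAt (inL a) (inL b) h k with lca-SplitAt a b h k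
  ... | inj₁ (l , r) = inj₁ (lb-L l , rb-L r)
  ... | inj₂ (r , l) = inj₂ (rb-L r , lb-L l)
  lca-SplitAt (inR a) (inR b) h k with lca-SplitAt a b h k
  ... | inj₁ (l , r) = inj₁ (lb-R l , rb-R r)
  ... | inj₂ (r , l) = inj₂ (rb-R r , lb-R l)
  lca-SplitAt (inL a) (inR b) h k = inj₁ (lb-here , rb-here)
  lca-SplitAt (inR a) (inL b) h k = inj₂ (rb-here , lb-here)
  lca-SplitAt atNd b h k = ⊥-elim (k tt)
  lca-SplitAt (inL a) atNd h k = ⊥-elim (h tt)
  lca-SplitAt (inR a) atNd h k = ⊥-elim (h tt)

  LeftBelow⇒Below-lchild : ∀ {t : Tr n} (p : Pos t) {u : Node t} → LeftBelow u (toNode p) → Below u (lchild p)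
  LeftBelow⇒Below-lchild here {inL u} lb-here = Below-top u
  LeftBelow⇒Below-lchild (goL p) (lb-L h) = LeftBelow⇒Below-lchild p h
  LeftBelow⇒Below-lchild (goR p) (lb-R h) = LeftBelow⇒Below-lchild p h

  RightBelow⇒Below-rchild : ∀ {t : Tr n} (p : Pos t) {u : Node t} → RightBelow u (toNode p) → Below u (rchild p)
  RightBelow⇒Below-rchild here {inR u} rb-here = Below-top u
  RightBelow⇒Below-rchild (goL p) (rb-L h) = RightBelow⇒Below-rchild p h
  RightBelow⇒Below-rchild (goR p) (rb-R h) = RightBelow⇒Below-rchild p h

  LeftBelow-inner-pos : ∀ {t : Tr n} {u w : Node t} → LeftBelow u w → Σ[ p ∈ Pos t ] w ≡ toNode p
  LeftBelow-inner-pos lb-here = here , refl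
  LeftBelow-inner-pos (lb-L h) with LeftBelow-inner-pos h
  ... | p , refl = goL p , refl
  LeftBelow-inner-pos (lb-R h) with LeftBelow-inner-pos h
  ... | p , refl = goR p , refl

  SplitAt⇒Belowˡ : ∀ {t : Tr n} {a b w : Node t} → SplitAt a b w → Below a w
  SplitAt⇒Belowˡ (inj₁ (l , _)) = LeftBelow⇒Below l
  SplitAt⇒Belowˡ (inj₂ (r , _)) = RightBelow⇒Below r

  SplitAt⇒Belowʳ : ∀ {t : Tr n} {a b w : Node t} → SplitAt a b w → Below b w
  SplitAt⇒Belowʳ s = SplitAt⇒Belowˡ (SplitAt-sym s)

  record Embedding (t s : Tr n) : Set where
    field
      emb : Node t → Node s
      emb-label : ∀ u i → labelOf u ≡ just i → labelOf (emb u) ≡ just i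
      emb-inner : ∀ u → labelOf u ≡ nothing → labelOf (emb u) ≡ nothing
      emb-split : ∀ p → SplitAt (emb (lchild p)) (emb (rchild p)) (emb (toNode p))
  open Embedding public

  Embedding-left : ∀ {l r s : Tr n} → Embedding (nd l r) s → Embedding l s
  Embedding-left w = record
    { emb = emb w ∘ inL ; emb-label = emb-label w ∘ inL ; emb-inner = emb-inner w ∘ inL ; emb-split = emb-split w ∘ goL }

  Embedding-right : ∀ {l r s : Tr n} → Embedding (nd l r) s → Embedding r s
  Embedding-right w = record
    { emb = emb w ∘ inR ; emb-label = emb-label w ∘ inR ; emb-inner = emb-inner w ∘ inR ; emb-split = emb-split w ∘ goR }

  emb-mono : ∀ {t s : Tr n} (w : Embedding t s) (u v : Node t) → Below u v → Below (emb w u) (emb w v)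
  emb-mono {lf i} w atLf atLf _ = Below-refl (emb w atLf)
  emb-mono {nd l r} w atNd atNd _ = Below-refl (emb w atNd)
  emb-mono {nd l r} w (inL u) atNd _ =
    Below-trans (emb w (inL u)) (emb w (inL (topNode l))) (emb w atNd)
      (emb-mono (Embedding-left w) u (topNode l) (Below-top u)) (SplitAt⇒Belowˡ (emb-split w here))
  emb-mono {nd l r} w (inR u) atNd _ =
    Below-trans (emb w (inR u)) (emb w (inR (topNode r))) (emb w atNd)
      (emb-mono (Embedding-right w) u (topNode r) (Below-top u)) (SplitAt⇒Belowʳ (emb-split w here))
  emb-mono {nd l r} w (inL u) (inL v) h = emb-mono (Embedding-left w) u v h
  emb-mono {nd l r} w (inR u) (inR v) h = emb-mono (Embedding-right w) u v h

  emb-SplitAt : ∀ {t s : Tr n} (w : Embedding t s) {a b c : Node t} → SplitAt a b c → SplitAt (emb w a) (emb w b) (emb w c)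
  emb-SplitAt w {a} {b} (inj₁ (l , r)) with LeftBelow-inner-pos l
  ... | p , refl =
    Below-SplitAt (emb-split w p) (emb-mono w a (lchild p) (LeftBelow⇒Below-lchild p l))
                                  (emb-mono w b (rchild p) (RightBelow⇒Below-rchild p r))
  emb-SplitAt w {a} {b} (inj₂ (r , l)) with LeftBelow-inner-pos l
  ... | p , refl =
    SplitAt-sym (Below-SplitAt (emb-split w p) (emb-mono w b (lchild p) (LeftBelow⇒Below-lchild p l))
                                               (emb-mono w a (rchild p) (RightBelow⇒Below-rchild p r)))

  emb-incomparable : ∀ {t s : Tr n} (w : Embedding t s) {a b : Node t} {x : Node s} → SplitAt (emb w a) (emb w b) x → ¬ Below a b
  emb-incomparable w {a} {b} s h = SplitAt⇒¬Below s (emb-mono w a b h)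

  emb-splitVertex : ∀ {t s : Tr n} (w : Embedding t s) (a b : Node t) (x : Node s) → SplitAt (emb w a) (emb w b) x →
    Σ[ c ∈ Node t ] labelOf c ≡ nothing × emb w c ≡ x
  emb-splitVertex w a b x s = lca a b , SplitAt-inner sp , SplitAt-unique (emb-SplitAt w sp) s
    where
    sp : SplitAt a b (lca a b)
    sp = lca-SplitAt a b (emb-incomparable w s) (emb-incomparable w (SplitAt-sym s))

  label∈leafLabels : ∀ (t : Tr n) (u : Node t) i → labelOf u ≡ just i → i ∈ leafLabels t
  label∈leafLabels (lf j) atLf i refl = here refl
  label∈leafLabels (nd l r) (inL u) i h = ∈-++⁺ˡ (label∈leafLabels l u i h)
  label∈leafLabels (nd l r) (inR u) i h = ∈-++⁺ʳ (leafLabels l) (label∈leafLabels r u i h)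

  ∈leafLabels⇒node : ∀ (t : Tr n) i → i ∈ leafLabels t → Σ[ u ∈ Node t ] labelOf u ≡ just i
  ∈leafLabels⇒node (lf j) i (here refl) = atLf , refl
  ∈leafLabels⇒node (nd l r) i h with ∈-++⁻ (leafLabels l) h
  ... | inj₁ k = let (u , q) = ∈leafLabels⇒node l i k in inL u , q
  ... | inj₂ k = let (u , q) = ∈leafLabels⇒node r i k in inR u , q

  label-injective : ∀ (t : Tr n) → Unique (leafLabels t) → ∀ (u v : Node t) i → labelOf u ≡ just i → labelOf v ≡ just i → u ≡ v
  label-injective (lf j) _ atLf atLf i _ _ = refl
  label-injective (nd l r) U (inL u) (inL v) i h k = cong inL (label-injective l (proj₁ (Unique-++⁻ (leafLabels l) U)) u v i h k)
  label-injective (nd l r) U (inR u) (inR v) i h k = cong inR (label-injective r (proj₁ (proj₂ (Unique-++⁻ (leafLabels l) U))) u v i h k)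
  label-injective (nd l r) U (inL u) (inR v) i h k =
    ⊥-elim (proj₂ (proj₂ (Unique-++⁻ (leafLabels l) U)) (label∈leafLabels l u i h , label∈leafLabels r v i k))
  label-injective (nd l r) U (inR u) (inL v) i h k =
    ⊥-elim (proj₂ (proj₂ (Unique-++⁻ (leafLabels l) U)) (label∈leafLabels l v i k , label∈leafLabels r u i h))

  leafNode : ∀ {S : Tr n} → Leaf S → Node S
  leafNode {lf i} tt = atLf
  leafNode {nd a b} (inj₁ x) = inL (leafNode x)
  leafNode {nd a b} (inj₂ x) = inR (leafNode x)

  -- t is the subtree of S spanned by the leaves satisfying P.
  record Spans {S t : Tr n} (P : Leaf S → Set) (w : Embedding t S) : Set where
    constructor mkSpans
    field
      injective : ∀ u v → emb w u ≡ emb w v → u ≡ v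
      leaf-image : ∀ u i → labelOf u ≡ just i → ∃[ a ] P a × emb w u ≡ leafNode a
      leaf-preimage : ∀ a → P a → ∃[ u ] emb w u ≡ leafNode a
      inner-image : ∀ u → labelOf u ≡ nothing → ∃₂ λ a b → P a × P b × SplitAt (leafNode a) (leafNode b) (emb w u)

  data Span (S : Tr n) (P : Leaf S → Set) : Set where
    spanned : ∀ t (w : Embedding t S) → Spans P w → Span S P
    none : (∀ a → ¬ P a) → Span S P

  someLabelledNode : ∀ (t : Tr n) → ∃₂ λ (u : Node t) i → labelOf u ≡ just i
  someLabelledNode (lf i) = atLf , i , refl
  someLabelledNode (nd l r) = let (u , i , h) = someLabelledNode l in inL u , i , h

  SplitAt-inL : ∀ {a b : Tr n} {x y z : Node a} → SplitAt x y z → SplitAt {t = nd a b} (inL x) (inL y) (inL z)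
  SplitAt-inL (inj₁ (l , r)) = inj₁ (lb-L l , rb-L r)
  SplitAt-inL (inj₂ (r , l)) = inj₂ (rb-L r , lb-L l)

  SplitAt-inR : ∀ {a b : Tr n} {x y z : Node b} → SplitAt x y z → SplitAt {t = nd a b} (inR x) (inR y) (inR z)
  SplitAt-inR (inj₁ (l , r)) = inj₁ (lb-R l , rb-R r)
  SplitAt-inR (inj₂ (r , l)) = inj₂ (rb-R r , lb-R l)

  inL-injective : ∀ {a b : Tr n} {u v : Node a} → _≡_ {A = Node (nd a b)} (inL u) (inL v) → u ≡ v
  inL-injective refl = refl

  inR-injective : ∀ {a b : Tr n} {u v : Node b} → _≡_ {A = Node (nd a b)} (inR u) (inR v) → u ≡ v
  inR-injective refl = refl

  Embedding-inL : ∀ {t a b : Tr n} → Embedding t a → Embedding t (nd a b)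
  Embedding-inL w = record
    { emb = λ u → inL (emb w u) ; emb-label = emb-label w ; emb-inner = emb-inner w ; emb-split = λ p → SplitAt-inL (emb-split w p) }

  Embedding-inR : ∀ {t a b : Tr n} → Embedding t b → Embedding t (nd a b)
  Embedding-inR w = record
    { emb = λ u → inR (emb w u) ; emb-label = emb-label w ; emb-inner = emb-inner w ; emb-split = λ p → SplitAt-inR (emb-split w p) }

  Embedding-nd : ∀ {t₁ t₂ a b : Tr n} → Embedding t₁ a → Embedding t₂ b → Embedding (nd t₁ t₂) (nd a b)
  Embedding-nd {t₁} {t₂} {a} {b} w₁ w₂ = record { emb = f ; emb-label = f-label ; emb-inner = f-inner ; emb-split = f-split }
    where
    f : Node (nd t₁ t₂) → Node (nd a b)
    f atNd = atNd
    f (inL u) = inL (emb w₁ u)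
    f (inR u) = inR (emb w₂ u)
    f-label : ∀ u i → labelOf u ≡ just i → labelOf (f u) ≡ just i
    f-label (inL u) = emb-label w₁ u
    f-label (inR u) = emb-label w₂ u
    f-inner : ∀ u → labelOf u ≡ nothing → labelOf (f u) ≡ nothing
    f-inner atNd _ = refl
    f-inner (inL u) = emb-inner w₁ u
    f-inner (inR u) = emb-inner w₂ u
    f-split : ∀ p → SplitAt (f (lchild p)) (f (rchild p)) (f (toNode p))
    f-split here = inj₁ (lb-here , rb-here)
    f-split (goL p) = SplitAt-inL (emb-split w₁ p)
    f-split (goR p) = SplitAt-inR (emb-split w₂ p)

  Spans-inL : ∀ {t a b : Tr n} {P : Leaf (nd a b) → Set} {w : Embedding t a} → Spans (P ∘ inj₁) w →
    (∀ y → ¬ P (inj₂ y)) → Spans P (Embedding-inL {b = b} w)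
  Spans-inL (mkSpans inj im pre inner) ¬P₂ = mkSpans
    (λ u v h → inj u v (inL-injective h))
    (λ u i h → let (x , px , ex) = im u i h in inj₁ x , px , cong inL ex)
    (λ { (inj₁ x) px → let (u , eu) = pre x px in u , cong inL eu ; (inj₂ y) py → ⊥-elim (¬P₂ y py) })
    (λ u h → let (x , y , px , py , s) = inner u h in inj₁ x , inj₁ y , px , py , SplitAt-inL s)

  Spans-inR : ∀ {t a b : Tr n} {P : Leaf (nd a b) → Set} {w : Embedding t b} → Spans (P ∘ inj₂) w →
    (∀ x → ¬ P (inj₁ x)) → Spans P (Embedding-inR {a = a} w)
  Spans-inR (mkSpans inj im pre inner) ¬P₁ = mkSpans
    (λ u v h → inj u v (inR-injective h))
    (λ u i h → let (x , px , ex) = im u i h in inj₂ x , px , cong inR ex)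
    (λ { (inj₂ x) px → let (u , eu) = pre x px in u , cong inR eu ; (inj₁ y) py → ⊥-elim (¬P₁ y py) })
    (λ u h → let (x , y , px , py , s) = inner u h in inj₂ x , inj₂ y , px , py , SplitAt-inR s)

  Spans-nd : ∀ {t₁ t₂ a b : Tr n} {P : Leaf (nd a b) → Set} {w₁ : Embedding t₁ a} {w₂ : Embedding t₂ b} →
    Spans (P ∘ inj₁) w₁ → Spans (P ∘ inj₂) w₂ → Spans P (Embedding-nd w₁ w₂)
  Spans-nd {t₁} {t₂} (mkSpans inj₁' im₁ pre₁ inner₁) (mkSpans inj₂' im₂ pre₂ inner₂) = mkSpans inj im pre inner
    where
    inj : ∀ u v → _ → u ≡ v
    inj atNd atNd _ = refl
    inj (inL u) (inL v) h = cong inL (inj₁' u v (inL-injective h))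
    inj (inR u) (inR v) h = cong inR (inj₂' u v (inR-injective h))
    inj atNd (inL v) ()
    inj atNd (inR v) ()
    inj (inL u) atNd ()
    inj (inR u) atNd ()
    inj (inL u) (inR v) ()
    inj (inR u) (inL v) ()
    im : ∀ u i → labelOf u ≡ just i → _
    im (inL u) i h = let (x , px , ex) = im₁ u i h in inj₁ x , px , cong inL ex
    im (inR u) i h = let (x , px , ex) = im₂ u i h in inj₂ x , px , cong inR ex
    pre : ∀ x → _ → _
    pre (inj₁ x) px = let (u , eu) = pre₁ x px in inL u , cong inL eu
    pre (inj₂ x) px = let (u , eu) = pre₂ x px in inR u , cong inR eu
    inner : ∀ u → labelOf u ≡ nothing → _
    inner atNd _ =
      let (u₁ , i₁ , k₁) = someLabelledNode t₁ ; (u₂ , i₂ , k₂) = someLabelledNode t₂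
          (x , px , _) = im₁ u₁ i₁ k₁ ; (y , py , _) = im₂ u₂ i₂ k₂
      in inj₁ x , inj₂ y , px , py , inj₁ (lb-here , rb-here)
    inner (inL u) h = let (x , y , px , py , s) = inner₁ u h in inj₁ x , inj₁ y , px , py , SplitAt-inL s
    inner (inR u) h = let (x , y , px , py , s) = inner₂ u h in inj₂ x , inj₂ y , px , py , SplitAt-inR s

  span : ∀ S {P : Leaf S → Set} → Decidable P → Span S P
  span (lf i) P? with P? tt
  ... | yes p = spanned (lf i) id-lf (mkSpans (λ { atLf atLf _ → refl }) (λ { atLf j h → tt , p , refl })
                                              (λ { tt _ → atLf , refl }) (λ { atLf () }))
    where
    id-lf : Embedding (lf i) (lf i)
    id-lf = record { emb = λ _ → atLf ; emb-label = λ { atLf j h → h } ; emb-inner = λ { atLf () } ; emb-split = λ () }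
  ... | no ¬p = none λ { tt → ¬p }
  span (nd a b) P? with span a (P? ∘ inj₁) | span b (P? ∘ inj₂)
  ... | none ¬P₁ | none ¬P₂ = none λ { (inj₁ x) → ¬P₁ x ; (inj₂ y) → ¬P₂ y }
  ... | spanned t w s | none ¬P₂ = spanned t (Embedding-inL w) (Spans-inL s ¬P₂)
  ... | none ¬P₁ | spanned t w s = spanned t (Embedding-inR w) (Spans-inR s ¬P₁)
  ... | spanned t₁ w₁ s₁ | spanned t₂ w₂ s₂ = spanned (nd t₁ t₂) (Embedding-nd w₁ w₂) (Spans-nd s₁ s₂)

-- Forests and their same-tree relations

module _ {n : ℕ} where

  leafLabel : ∀ {S : Tr n} → Leaf S → Fin n
  leafLabel {lf i} tt = i
  leafLabel {nd a b} (inj₁ x) = leafLabel x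
  leafLabel {nd a b} (inj₂ x) = leafLabel x

  labelOf-leafNode : ∀ {S : Tr n} (x : Leaf S) → labelOf (leafNode x) ≡ just (leafLabel x)
  labelOf-leafNode {lf i} tt = refl
  labelOf-leafNode {nd a b} (inj₁ x) = labelOf-leafNode x
  labelOf-leafNode {nd a b} (inj₂ x) = labelOf-leafNode x

  labelled⇒leafNode : ∀ {S : Tr n} (u : Node S) i → labelOf u ≡ just i → ∃[ x ] u ≡ leafNode x × leafLabel x ≡ i
  labelled⇒leafNode {lf j} atLf i refl = tt , refl , refl
  labelled⇒leafNode {nd a b} (inL u) i h = let (x , u≡ , l) = labelled⇒leafNode u i h in inj₁ x , cong inL u≡ , l
  labelled⇒leafNode {nd a b} (inR u) i h = let (x , u≡ , l) = labelled⇒leafNode u i h in inj₂ x , cong inR u≡ , l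
  labelled⇒leafNode {nd a b} atNd i ()

  leafNode-injective : ∀ {S : Tr n} (x y : Leaf S) → leafNode x ≡ leafNode y → x ≡ y
  leafNode-injective {lf i} tt tt _ = refl
  leafNode-injective {nd a b} (inj₁ x) (inj₁ y) h = cong inj₁ (leafNode-injective x y (inL-injective h))
  leafNode-injective {nd a b} (inj₂ x) (inj₂ y) h = cong inj₂ (leafNode-injective x y (inR-injective h))
  leafNode-injective {nd a b} (inj₁ x) (inj₂ y) ()
  leafNode-injective {nd a b} (inj₂ x) (inj₁ y) ()

  SameTree : Forest n → Fin n → Fin n → Set
  SameTree F i j = ∃[ k ] i ∈ leafLabels (lookup F k) × j ∈ leafLabels (lookup F k)

  ∈-concatMap⁻ : ∀ (F : Forest n) i → i ∈ concatMap leafLabels F → ∃[ k ] i ∈ leafLabels (lookup F k)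
  ∈-concatMap⁻ (t ∷ F) i h with ∈-++⁻ (leafLabels t) h
  ... | inj₁ k = Fin.zero , k
  ... | inj₂ k = let (k' , m) = ∈-concatMap⁻ F i k in Fin.suc k' , m

  ∈-concatMap⁺ : ∀ (F : Forest n) k i → i ∈ leafLabels (lookup F k) → i ∈ concatMap leafLabels F
  ∈-concatMap⁺ (t ∷ F) Fin.zero i h = ∈-++⁺ˡ h
  ∈-concatMap⁺ (t ∷ F) (Fin.suc k) i h = ∈-++⁺ʳ (leafLabels t) (∈-concatMap⁺ F k i h)

  treeIndex-unique : ∀ (F : Forest n) → Unique (concatMap leafLabels F) → ∀ k k' i →
    i ∈ leafLabels (lookup F k) → i ∈ leafLabels (lookup F k') → k ≡ k'
  treeIndex-unique (t ∷ F) U Fin.zero Fin.zero i h h' = refl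
  treeIndex-unique (t ∷ F) U (Fin.suc k) (Fin.suc k') i h h' =
    cong Fin.suc (treeIndex-unique F (proj₁ (proj₂ (Unique-++⁻ (leafLabels t) U))) k k' i h h')
  treeIndex-unique (t ∷ F) U Fin.zero (Fin.suc k') i h h' =
    ⊥-elim (proj₂ (proj₂ (Unique-++⁻ (leafLabels t) U)) (h , ∈-concatMap⁺ F k' i h'))
  treeIndex-unique (t ∷ F) U (Fin.suc k) Fin.zero i h h' =
    ⊥-elim (proj₂ (proj₂ (Unique-++⁻ (leafLabels t) U)) (h' , ∈-concatMap⁺ F k i h))

  SameTree? : ∀ (F : Forest n) i j → Dec (SameTree F i j)
  SameTree? F i j = any? λ k → Any.any? (i ≟ᶠ_) (leafLabels (lookup F k)) ×-dec Any.any? (j ≟ᶠ_) (leafLabels (lookup F k))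

  constant-on-tree : ∀ (t : Tr n) {X : Set} (h : Node t → X) →
    (∀ p → h (lchild p) ≡ h (toNode p) × h (rchild p) ≡ h (toNode p)) → ∀ u → h u ≡ h (topNode t)
  constant-on-tree (lf i) h H atLf = refl
  constant-on-tree (nd l r) h H atNd = refl
  constant-on-tree (nd l r) h H (inL u) =
    trans (constant-on-tree l (λ v → h (inL v)) (λ p → H (goL p)) u) (proj₁ (H here))
  constant-on-tree (nd l r) h H (inR u) =
    trans (constant-on-tree r (λ v → h (inR v)) (λ p → H (goR p)) u) (proj₂ (H here))

  SplitAt⇒Split : ∀ {F : Forest n} {k} {x y z : Node (lookup F k)} → SplitAt x y z → Split F (k , x) (k , y) (k , z)
  SplitAt⇒Split (inj₁ (l , r)) = split-lr l r
  SplitAt⇒Split (inj₂ (r , l)) = split-rl r l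

  Split-index : ∀ {G : Forest n} {a b w : Vtx G} → Split G a b w → proj₁ a ≡ proj₁ w × proj₁ b ≡ proj₁ w
  Split-index (split-lr _ _) = refl , refl
  Split-index (split-rl _ _) = refl , refl

  ψ-index-constant : ∀ {F G : Forest n} (ψ : F ≤F G) k u →
    proj₁ (_≤F_.ψ ψ (k , u)) ≡ proj₁ (_≤F_.ψ ψ (k , topNode (lookup F k)))
  ψ-index-constant {F} ψ k =
    constant-on-tree (lookup F k) (λ v → proj₁ (_≤F_.ψ ψ (k , v))) (λ p → Split-index (_≤F_.onEdges ψ k p))

  ≤F⇒SameTree⊆ : ∀ {F G : Forest n} → F ≤F G → ∀ i j → SameTree F i j → SameTree G i j
  ≤F⇒SameTree⊆ {F} {G} ψ i j (k , mi , mj) with ∈leafLabels⇒node (lookup F k) i mi | ∈leafLabels⇒node (lookup F k) j mj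
  ... | ui , hi | uj , hj =
    k₀ , subst (λ z → i ∈ leafLabels (lookup G z)) (ψ-index-constant ψ k ui) (memOf ui i hi) ,
         subst (λ z → j ∈ leafLabels (lookup G z)) (ψ-index-constant ψ k uj) (memOf uj j hj)
    where
    k₀ = proj₁ (_≤F_.ψ ψ (k , topNode (lookup F k)))
    memOf : ∀ u l → labelOf u ≡ just l → l ∈ leafLabels (lookup G (proj₁ (_≤F_.ψ ψ (k , u))))
    memOf u l h = label∈leafLabels _ (proj₂ (_≤F_.ψ ψ (k , u))) l (_≤F_.onLeaves ψ (k , u) l h)

  firstLabel : Tr n → Fin n
  firstLabel (lf i) = i
  firstLabel (nd l r) = firstLabel l

  firstLabel∈ : ∀ t → firstLabel t ∈ leafLabels t
  firstLabel∈ (lf i) = here refl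
  firstLabel∈ (nd l r) = ∈-++⁺ˡ (firstLabel∈ l)

  CompatibleAt : ∀ (S : Tr n) → (Leaf S → Leaf S → Set) → Set
  CompatibleAt S Q = ∀ (p : Pos S) a a' b b' → LeftBelow (leafNode a) (toNode p) → LeftBelow (leafNode a') (toNode p) →
    RightBelow (leafNode b) (toNode p) → RightBelow (leafNode b') (toNode p) → Q a b → Q a' b' → Q a a'

  CompatibleAt⇒Compatible : ∀ S (Q : Leaf S → Leaf S → Set) → CompatibleAt S Q → Compatible S Q
  CompatibleAt⇒Compatible (lf i) Q H = tt
  CompatibleAt⇒Compatible (nd l r) Q H =
    CompatibleAt⇒Compatible l _ (λ p a a' b b' h₁ h₂ h₃ h₄ →
      H (goL p) (inj₁ a) (inj₁ a') (inj₁ b) (inj₁ b') (lb-L h₁) (lb-L h₂) (rb-L h₃) (rb-L h₄)) ,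
    CompatibleAt⇒Compatible r _ (λ p a a' b b' h₁ h₂ h₃ h₄ →
      H (goR p) (inj₂ a) (inj₂ a') (inj₂ b) (inj₂ b') (lb-R h₁) (lb-R h₂) (rb-R h₃) (rb-R h₄)) ,
    (λ x x' y y' q q' → H here (inj₁ x) (inj₁ x') (inj₂ y) (inj₂ y') lb-here lb-here rb-here rb-here q q')

  LeftBelow-atNd : ∀ {l r : Tr n} (a : Leaf (nd l r)) → LeftBelow (leafNode a) atNd → ∃[ a₁ ] a ≡ inj₁ a₁
  LeftBelow-atNd (inj₁ a₁) lb-here = a₁ , refl

  RightBelow-atNd : ∀ {l r : Tr n} (a : Leaf (nd l r)) → RightBelow (leafNode a) atNd → ∃[ a₁ ] a ≡ inj₂ a₁
  RightBelow-atNd (inj₂ a₁) rb-here = a₁ , refl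

  LeftBelow-inL : ∀ {l r : Tr n} (a : Leaf (nd l r)) {w} → LeftBelow (leafNode a) (inL w) →
    ∃[ a₁ ] a ≡ inj₁ a₁ × LeftBelow (leafNode a₁) w
  LeftBelow-inL (inj₁ a₁) (lb-L h) = a₁ , refl , h

  RightBelow-inL : ∀ {l r : Tr n} (a : Leaf (nd l r)) {w} → RightBelow (leafNode a) (inL w) →
    ∃[ a₁ ] a ≡ inj₁ a₁ × RightBelow (leafNode a₁) w
  RightBelow-inL (inj₁ a₁) (rb-L h) = a₁ , refl , h

  LeftBelow-inR : ∀ {l r : Tr n} (a : Leaf (nd l r)) {w} → LeftBelow (leafNode a) (inR w) →
    ∃[ a₁ ] a ≡ inj₂ a₁ × LeftBelow (leafNode a₁) w
  LeftBelow-inR (inj₂ a₁) (lb-R h) = a₁ , refl , h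

  RightBelow-inR : ∀ {l r : Tr n} (a : Leaf (nd l r)) {w} → RightBelow (leafNode a) (inR w) →
    ∃[ a₁ ] a ≡ inj₂ a₁ × RightBelow (leafNode a₁) w
  RightBelow-inR (inj₂ a₁) (rb-R h) = a₁ , refl , h

  SameBlock-compatibleAt : ∀ {S : Tr n} (p : Partition S) (w : Node S) a b a' b' →
    LeftBelow (leafNode a) w → RightBelow (leafNode b) w → LeftBelow (leafNode a') w → RightBelow (leafNode b') w →
    SameBlock p a b → SameBlock p a' b' → SameBlock p a a'
  SameBlock-compatibleAt leaf atLf a b a' b' () _ _ _ _ _
  SameBlock-compatibleAt (node p₁ p₂ m) atNd a b a' b' h₁ h₂ h₃ h₄ a∼b a'∼b'
    with LeftBelow-atNd a h₁ | RightBelow-atNd b h₂ | LeftBelow-atNd a' h₃ | RightBelow-atNd b' h₄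
  SameBlock-compatibleAt (node p₁ p₂ nothing) atNd _ _ _ _ _ _ _ _ () _ | _ , refl | _ , refl | _ , refl | _ , refl
  SameBlock-compatibleAt (node p₁ p₂ (just (c , d))) atNd _ _ _ _ _ _ _ _ (a∼c , _) (a'∼c , _)
    | a₁ , refl | _ , refl | a₁' , refl | _ , refl = SameBlock-trans p₁ a₁ c a₁' a∼c (SameBlock-sym p₁ a₁' c a'∼c)
  SameBlock-compatibleAt (node p₁ p₂ m) (inL w) a b a' b' h₁ h₂ h₃ h₄ a∼b a'∼b'
    with LeftBelow-inL a h₁ | RightBelow-inL b h₂ | LeftBelow-inL a' h₃ | RightBelow-inL b' h₄
  ... | a₁ , refl , k₁ | b₁ , refl , k₂ | a₁' , refl , k₃ | b₁' , refl , k₄ =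
    SameBlock-compatibleAt p₁ w a₁ b₁ a₁' b₁' k₁ k₂ k₃ k₄ a∼b a'∼b'
  SameBlock-compatibleAt (node p₁ p₂ m) (inR w) a b a' b' h₁ h₂ h₃ h₄ a∼b a'∼b'
    with LeftBelow-inR a h₁ | RightBelow-inR b h₂ | LeftBelow-inR a' h₃ | RightBelow-inR b' h₄
  ... | a₁ , refl , k₁ | b₁ , refl , k₂ | a₁' , refl , k₃ | b₁' , refl , k₄ =
    SameBlock-compatibleAt p₂ w a₁ b₁ a₁' b₁' k₁ k₂ k₃ k₄ a∼b a'∼b'

  SameBlock-SplitAt : ∀ {S : Tr n} (p : Partition S) (w : Node S) a b a' b' →
    SplitAt (leafNode a) (leafNode b) w → SplitAt (leafNode a') (leafNode b') w →
    SameBlock p a b → SameBlock p a' b' → SameBlock p a a' ⊎ SameBlock p a b'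
  SameBlock-SplitAt p w a b a' b' (inj₁ (l , r)) (inj₁ (l' , r')) q q' =
    inj₁ (SameBlock-compatibleAt p w a b a' b' l r l' r' q q')
  SameBlock-SplitAt p w a b a' b' (inj₁ (l , r)) (inj₂ (r' , l')) q q' =
    inj₂ (SameBlock-compatibleAt p w a b b' a' l r l' r' q (SameBlock-sym p a' b' q'))
  SameBlock-SplitAt p w a b a' b' (inj₂ (r , l)) (inj₁ (l' , r')) q q' =
    inj₁ (SameBlock-trans p a b a' q (SameBlock-compatibleAt p w b a a' b' l r l' r' (SameBlock-sym p a b q) q'))
  SameBlock-SplitAt p w a b a' b' (inj₂ (r , l)) (inj₂ (r' , l')) q q' =
    inj₂ (SameBlock-trans p a b b' q (SameBlock-compatibleAt p w b a b' a' l r l' r' (SameBlock-sym p a b q) (SameBlock-sym p a' b' q')))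

-- The interval [0̂, T]

module BelowTree {n : ℕ} (T : Tr n) (T-unique : Unique (leafLabels T)) (T-covers : ∀ i → i ∈ leafLabels T) where

  leafLabel-injective : (x y : Leaf T) → leafLabel x ≡ leafLabel y → x ≡ y
  leafLabel-injective x y h =
    leafNode-injective x y
      (label-injective T T-unique (leafNode x) (leafNode y) (leafLabel x) (labelOf-leafNode x) (trans (labelOf-leafNode y) (cong just (sym h))))

  leafLabel-surjective : ∀ i → Σ[ x ∈ Leaf T ] leafLabel x ≡ i
  leafLabel-surjective i = let (u , h) = ∈leafLabels⇒node T i (T-covers i) ; (x , _ , l) = labelled⇒leafNode u i h in x , l

  labelled≡leafNode : ∀ (u : Node T) (x : Leaf T) → labelOf u ≡ just (leafLabel x) → u ≡ leafNode x
  labelled≡leafNode u x h = label-injective T T-unique u (leafNode x) (leafLabel x) h (labelOf-leafNode x)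

  forest : IntervalElt T → Forest n
  forest x = proj₁ x

  SameTreeᴸ : IntervalElt T → Leaf T → Leaf T → Set
  SameTreeᴸ x a b = SameTree (forest x) (leafLabel a) (leafLabel b)

  SameTreeᴸ-isDecEquivalence : ∀ x → IsDecEquivalence (SameTreeᴸ x)
  SameTreeᴸ-isDecEquivalence (F , (F-unique , F-covers) , _) = record
    { isEquivalence = record
      { refl = λ {a} → let (k , m) = ∈-concatMap⁻ F (leafLabel a) (F-covers (leafLabel a)) in k , m , m
      ; sym = λ (k , a∈ , b∈) → k , b∈ , a∈
      ; trans = λ {a} {b} {c} (k , a∈ , b∈) (k' , b∈' , c∈) →
          k , a∈ , subst (λ z → leafLabel c ∈ leafLabels (lookup F z)) (sym (treeIndex-unique F F-unique k k' (leafLabel b) b∈ b∈')) c∈ }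
    ; _≟_ = λ a b → SameTree? F (leafLabel a) (leafLabel b) }

  vertexOfT : Vtx (T ∷ []) → Node T
  vertexOfT (Fin.zero , u) = u

  vertexOfT-injective : ∀ (v w : Vtx (T ∷ [])) → vertexOfT v ≡ vertexOfT w → v ≡ w
  vertexOfT-injective (Fin.zero , u) (Fin.zero , .u) refl = refl

  vertexOfT-label : ∀ (v : Vtx (T ∷ [])) → vlabel (T ∷ []) v ≡ labelOf (vertexOfT v)
  vertexOfT-label (Fin.zero , u) = refl

  Split⇒SplitAt : ∀ {a b w : Vtx (T ∷ [])} → Split (T ∷ []) a b w → SplitAt (vertexOfT a) (vertexOfT b) (vertexOfT w)
  Split⇒SplitAt (split-lr {k = Fin.zero} l r) = inj₁ (l , r)
  Split⇒SplitAt (split-rl {k = Fin.zero} r l) = inj₂ (r , l)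

  treeEmbedding : ∀ {F : Forest n} → F ≤F (T ∷ []) → (k : Fin (length F)) → Embedding (lookup F k) T
  treeEmbedding ψ k = record
    { emb = λ u → vertexOfT (_≤F_.ψ ψ (k , u))
    ; emb-label = λ u i h → trans (sym (vertexOfT-label (_≤F_.ψ ψ (k , u)))) (_≤F_.onLeaves ψ (k , u) i h)
    ; emb-inner = λ u h → trans (sym (vertexOfT-label (_≤F_.ψ ψ (k , u)))) (_≤F_.onInner ψ (k , u) h)
    ; emb-split = λ p → Split⇒SplitAt (_≤F_.onEdges ψ k p) }

  -- The image of an inner vertex is forced: it is where the images of its two children split.
  factorEmbedding : ∀ (t t' : Tr n) (e : Embedding t T) (e' : Embedding t' T) →
    (∀ (u : Node t) i → labelOf u ≡ just i → Σ[ u' ∈ Node t' ] labelOf u' ≡ just i) →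
    Σ[ w ∈ Embedding t t' ] ∀ u → emb e' (emb w u) ≡ emb e u
  factorEmbedding (lf i) t' e e' labels = w , commutes
    where
    u' = proj₁ (labels atLf i refl)
    w : Embedding (lf i) t'
    w = record
      { emb = λ _ → u' ; emb-label = λ { atLf j refl → proj₂ (labels atLf i refl) } ; emb-inner = λ { atLf () } ; emb-split = λ () }
    commutes : ∀ u → emb e' (emb w u) ≡ emb e u
    commutes atLf = label-injective T T-unique _ _ i (emb-label e' u' i (proj₂ (labels atLf i refl))) (emb-label e atLf i refl)
  factorEmbedding (nd l r) t' e e' labels = w , commutes
    where
    left = factorEmbedding l t' (Embedding-left e) e' (λ u → labels (inL u))
    right = factorEmbedding r t' (Embedding-right e) e' (λ u → labels (inR u))
    wˡ = proj₁ left
    wʳ = proj₁ right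
    a = emb wˡ (topNode l)
    b = emb wʳ (topNode r)
    split-in-T : SplitAt (emb e' a) (emb e' b) (emb e atNd)
    split-in-T = subst₂ (λ x y → SplitAt x y (emb e atNd)) (sym (proj₂ left (topNode l))) (sym (proj₂ right (topNode r)))
                        (emb-split e here)
    split : SplitAt a b (lca a b)
    split = lca-SplitAt a b (emb-incomparable e' split-in-T) (emb-incomparable e' (SplitAt-sym split-in-T))
    f : Node (nd l r) → Node t'
    f atNd = lca a b
    f (inL u) = emb wˡ u
    f (inR u) = emb wʳ u
    w : Embedding (nd l r) t'
    w = record
      { emb = f
      ; emb-label = λ { (inL u) → emb-label wˡ u ; (inR u) → emb-label wʳ u }
      ; emb-inner = λ { atNd _ → SplitAt-inner split ; (inL u) → emb-inner wˡ u ; (inR u) → emb-inner wʳ u }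
      ; emb-split = λ { here → split ; (goL p) → emb-split wˡ p ; (goR p) → emb-split wʳ p } }
    commutes : ∀ u → emb e' (emb w u) ≡ emb e u
    commutes atNd = SplitAt-unique (emb-SplitAt e' split) split-in-T
    commutes (inL u) = proj₂ left u
    commutes (inR u) = proj₂ right u

  SameTree⊆⇒≤F : ∀ (x y : IntervalElt T) → (∀ i j → SameTree (forest x) i j → SameTree (forest y) i j) → forest x ≤F forest y
  SameTree⊆⇒≤F (F , (F-unique , F-covers) , ψF) (G , (G-unique , G-covers) , ψG) sameTree⊆ = record
    { ψ = λ { (k , u) → target k , emb (w k) u }
    ; onLeaves = λ { (k , u) → emb-label (w k) u }
    ; onInner = λ { (k , u) → emb-inner (w k) u }
    ; innerInj = λ { (k₁ , u₁) (k₂ , u₂) inner₁ inner₂ eq →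
        _≤F_.innerInj ψF (k₁ , u₁) (k₂ , u₂) inner₁ inner₂ (vertexOfT-injective _ _ (same-in-T k₁ u₁ k₂ u₂ eq)) }
    ; onEdges = λ k p → SplitAt⇒Split (emb-split (w k) p) }
    where
    target : Fin (length F) → Fin (length G)
    target k = proj₁ (∈-concatMap⁻ G (firstLabel (lookup F k)) (G-covers _))
    first∈target : ∀ k → firstLabel (lookup F k) ∈ leafLabels (lookup G (target k))
    first∈target k = proj₂ (∈-concatMap⁻ G (firstLabel (lookup F k)) (G-covers _))
    labels-in-target : ∀ k u i → labelOf u ≡ just i → Σ[ u' ∈ Node (lookup G (target k)) ] labelOf u' ≡ just i
    labels-in-target k u i h with sameTree⊆ i (firstLabel (lookup F k)) (k , label∈leafLabels (lookup F k) u i h , firstLabel∈ (lookup F k))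
    ... | k' , i∈ , first∈ =
      ∈leafLabels⇒node (lookup G (target k)) i
        (subst (λ z → i ∈ leafLabels (lookup G z)) (treeIndex-unique G G-unique k' (target k) _ first∈ (first∈target k)) i∈)
    factor : ∀ k → _
    factor k = factorEmbedding (lookup F k) (lookup G (target k)) (treeEmbedding ψF k) (treeEmbedding ψG (target k)) (labels-in-target k)
    w : ∀ k → Embedding (lookup F k) (lookup G (target k))
    w k = proj₁ (factor k)
    same-in-T : ∀ k₁ u₁ k₂ u₂ → _≡_ {A = Vtx G} (target k₁ , emb (w k₁) u₁) (target k₂ , emb (w k₂) u₂) →
      vertexOfT (_≤F_.ψ ψF (k₁ , u₁)) ≡ vertexOfT (_≤F_.ψ ψF (k₂ , u₂))
    same-in-T k₁ u₁ k₂ u₂ eq = trans (sym (proj₂ (factor k₁) u₁)) (trans (cong (λ v → vertexOfT (_≤F_.ψ ψG v)) eq) (proj₂ (factor k₂) u₂))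
  crossingVertex : ∀ (F : Forest n) (ψ : F ≤F (T ∷ [])) (p : Pos T) a b → LeftBelow (leafNode a) (toNode p) →
    RightBelow (leafNode b) (toNode p) → ∀ k → leafLabel a ∈ leafLabels (lookup F k) → leafLabel b ∈ leafLabels (lookup F k) →
    Σ[ c ∈ Node (lookup F k) ] labelOf c ≡ nothing × emb (treeEmbedding ψ k) c ≡ toNode p
  crossingVertex F ψ p a b h₁ h₂ k ma mb
    with ∈leafLabels⇒node (lookup F k) (leafLabel a) ma | ∈leafLabels⇒node (lookup F k) (leafLabel b) mb
  ... | ua , la | ub , lb' =
    emb-splitVertex (treeEmbedding ψ k) ua ub (toNode p)
      (inj₁ (subst (λ z → LeftBelow z (toNode p)) (sym (labelled≡leafNode _ a (emb-label (treeEmbedding ψ k) ua (leafLabel a) la))) h₁ ,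
             subst (λ z → RightBelow z (toNode p)) (sym (labelled≡leafNode _ b (emb-label (treeEmbedding ψ k) ub (leafLabel b) lb'))) h₂))

  SameTreeᴸ-compatible : ∀ x → Compatible T (SameTreeᴸ x)
  SameTreeᴸ-compatible (F , (UF , CF) , ψ) = CompatibleAt⇒Compatible T _ H
    where
    H : CompatibleAt T (λ a b → SameTree F (leafLabel a) (leafLabel b))
    H p a a' b b' h₁ h₂ h₃ h₄ (k₁ , ma , mb) (k₂ , ma' , mb')
      with crossingVertex F ψ p a b h₁ h₃ k₁ ma mb | crossingVertex F ψ p a' b' h₂ h₄ k₂ ma' mb'
    ... | c₁ , i₁ , e₁ | c₂ , i₂ , e₂ =
      k₁ , ma , subst (λ z → leafLabel a' ∈ leafLabels (lookup F z)) (sym (cong proj₁ same)) ma'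
      where
      same : _≡_ {A = Vtx F} (k₁ , c₁) (k₂ , c₂)
      same = _≤F_.innerInj ψ (k₁ , c₁) (k₂ , c₂) i₁ i₂ (vertexOfT-injective _ _ (trans e₁ (sym e₂)))

  Embedding-unique-labels : ∀ (t : Tr n) (w : Embedding t T) → (∀ u v → emb w u ≡ emb w v → u ≡ v) → Unique (leafLabels t)
  Embedding-unique-labels (lf i) w _ = [] ∷ []
  Embedding-unique-labels (nd l r) w inj =
    Unique.++⁺ (Embedding-unique-labels l (Embedding-left w) (λ u v h → inL-injective (inj (inL u) (inL v) h)))
               (Embedding-unique-labels r (Embedding-right w) (λ u v h → inR-injective (inj (inR u) (inR v) h))) disjoint
    where
    disjoint : Disjoint (leafLabels l) (leafLabels r)
    disjoint {i} (i∈l , i∈r) with ∈leafLabels⇒node l i i∈l | ∈leafLabels⇒node r i i∈r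
    ... | u₁ , h₁ | u₂ , h₂
      with inj (inL u₁) (inR u₂) (label-injective T T-unique _ _ i (emb-label w (inL u₁) i h₁) (emb-label w (inR u₂) i h₂))
    ... | ()

  -- The forest of the subtrees of T spanned by the blocks of p, one for each representative.
  module Decode (p : Partition T) where

    BlockTree : Leaf T → Set
    BlockTree r = ∃₂ λ t (w : Embedding t T) → Spans (SameBlock p r) w

    blockTree : ∀ r → BlockTree r
    blockTree r with span T (SameBlock? p r)
    ... | spanned t w s = t , w , s
    ... | none ¬r∼ = ⊥-elim (¬r∼ r (SameBlock-refl p r))

    blockForest : List (Leaf T) → Forest n
    blockForest [] = []
    blockForest (r ∷ rs) = proj₁ (blockTree r) ∷ blockForest rs

    representativeAt : ∀ rs → Fin (length (blockForest rs)) → Leaf T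
    representativeAt (r ∷ rs) Fin.zero = r
    representativeAt (r ∷ rs) (Fin.suc k) = representativeAt rs k

    embeddingAt : ∀ rs (k : Fin (length (blockForest rs))) → Embedding (lookup (blockForest rs) k) T
    embeddingAt (r ∷ rs) Fin.zero = proj₁ (proj₂ (blockTree r))
    embeddingAt (r ∷ rs) (Fin.suc k) = embeddingAt rs k

    spansAt : ∀ rs k → Spans (SameBlock p (representativeAt rs k)) (embeddingAt rs k)
    spansAt (r ∷ rs) Fin.zero = proj₂ (proj₂ (blockTree r))
    spansAt (r ∷ rs) (Fin.suc k) = spansAt rs k

    All-representativeAt : ∀ {P : Leaf T → Set} rs → All P rs → ∀ k → P (representativeAt rs k)
    All-representativeAt (r ∷ rs) (h ∷ hs) Fin.zero = h
    All-representativeAt (r ∷ rs) (h ∷ hs) (Fin.suc k) = All-representativeAt rs hs k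

    Any-representativeAt : ∀ {P : Leaf T → Set} rs → Any P rs → ∃[ k ] P (representativeAt rs k)
    Any-representativeAt (r ∷ rs) (here h) = Fin.zero , h
    Any-representativeAt (r ∷ rs) (there h) = let (k , q) = Any-representativeAt rs h in Fin.suc k , q

    representativeAt-injective : ∀ rs → AllPairs (λ r r' → ¬ SameBlock p r r') rs →
      ∀ k₁ k₂ → SameBlock p (representativeAt rs k₁) (representativeAt rs k₂) → k₁ ≡ k₂
    representativeAt-injective (r ∷ rs) (h ∷ hs) Fin.zero Fin.zero q = refl
    representativeAt-injective (r ∷ rs) (h ∷ hs) (Fin.suc k₁) (Fin.suc k₂) q = cong Fin.suc (representativeAt-injective rs hs k₁ k₂ q)
    representativeAt-injective (r ∷ rs) (h ∷ hs) Fin.zero (Fin.suc k₂) q = ⊥-elim (All-representativeAt rs h k₂ q)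
    representativeAt-injective (r ∷ rs) (h ∷ hs) (Fin.suc k₁) Fin.zero q = ⊥-elim (All-representativeAt rs h k₁ (SameBlock-sym p _ _ q))

    blockForest-label⁻ : ∀ rs k i → i ∈ leafLabels (lookup (blockForest rs) k) →
      ∃[ a ] SameBlock p (representativeAt rs k) a × leafLabel a ≡ i
    blockForest-label⁻ rs k i i∈ with ∈leafLabels⇒node _ i i∈
    ... | u , h with Spans.leaf-image (spansAt rs k) u i h
    ...   | a , r∼a , u↦a =
      a , r∼a , just-injective (trans (sym (labelOf-leafNode a)) (trans (cong labelOf (sym u↦a)) (emb-label (embeddingAt rs k) u i h)))

    blockForest-label⁺ : ∀ rs k a → SameBlock p (representativeAt rs k) a → leafLabel a ∈ leafLabels (lookup (blockForest rs) k)
    blockForest-label⁺ rs k a r∼a with Spans.leaf-preimage (spansAt rs k) a r∼a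
    ... | u , u↦a with labelOf u in u-label
    ...   | nothing with () ← trans (sym (trans (cong labelOf (sym u↦a)) (emb-inner (embeddingAt rs k) u u-label))) (labelOf-leafNode a)
    ...   | just j = subst (λ z → z ∈ leafLabels (lookup (blockForest rs) k))
                       (just-injective (trans (sym (emb-label (embeddingAt rs k) u j u-label)) (trans (cong labelOf u↦a) (labelOf-leafNode a))))
                       (label∈leafLabels _ u j u-label)

    blockForest-unique : ∀ rs → AllPairs (λ r r' → ¬ SameBlock p r r') rs → Unique (concatMap leafLabels (blockForest rs))
    blockForest-unique [] [] = []
    blockForest-unique (r ∷ rs) (h ∷ hs) =
      Unique.++⁺ (Embedding-unique-labels _ (proj₁ (proj₂ (blockTree r))) (Spans.injective (proj₂ (proj₂ (blockTree r)))))
                 (blockForest-unique rs hs) disjoint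
      where
      disjoint : Disjoint (leafLabels (proj₁ (blockTree r))) (concatMap leafLabels (blockForest rs))
      disjoint {i} (i∈r , i∈rs) with blockForest-label⁻ (r ∷ rs) Fin.zero i i∈r | ∈-concatMap⁻ (blockForest rs) i i∈rs
      ... | a , r∼a , a↦i | k , i∈k with blockForest-label⁻ rs k i i∈k
      ...   | a' , k∼a' , a'↦i with leafLabel-injective a a' (trans a↦i (sym a'↦i))
      ...     | refl = All-representativeAt rs h k (SameBlock-trans p r a (representativeAt rs k) r∼a (SameBlock-sym p _ a k∼a'))

    representatives : List (Leaf T)
    representatives = deduplicate (SameBlock? p) (allLeaves T)

    representatives-apart : AllPairs (λ r r' → ¬ SameBlock p r r') representatives
    representatives-apart = deduplicate-! (blocks-decSetoid p) (allLeaves T)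

    representative-of : ∀ a → ∃[ k ] SameBlock p (representativeAt representatives k) a
    representative-of a =
      Any-representativeAt representatives
        (Any.deduplicate⁺ (SameBlock? p) (λ {x} {y} y∼x x∼a → SameBlock-trans p y x a y∼x x∼a)
          (Any.map (λ { refl → SameBlock-refl p a }) (∈-allLeaves T a)))

    decodedForest : Forest n
    decodedForest = blockForest representatives

    decodedForest-covers : ∀ i → i ∈ concatMap leafLabels decodedForest
    decodedForest-covers i with leafLabel-surjective i
    ... | a , refl with representative-of a
    ...   | k , k∼a = ∈-concatMap⁺ decodedForest k (leafLabel a) (blockForest-label⁺ representatives k a k∼a)

    decodedMap : Vtx decodedForest → Vtx (T ∷ [])
    decodedMap (k , u) = Fin.zero , emb (embeddingAt representatives k) u

    inner-sameTree : ∀ k₁ k₂ (u₁ : Node (lookup decodedForest k₁)) (u₂ : Node (lookup decodedForest k₂)) →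
      labelOf u₁ ≡ nothing → labelOf u₂ ≡ nothing →
      emb (embeddingAt representatives k₁) u₁ ≡ emb (embeddingAt representatives k₂) u₂ → k₁ ≡ k₂
    inner-sameTree k₁ k₂ u₁ u₂ inner₁ inner₂ same-vertex
      with Spans.inner-image (spansAt representatives k₁) u₁ inner₁ | Spans.inner-image (spansAt representatives k₂) u₂ inner₂
    ... | a₁ , b₁ , r∼a₁ , r∼b₁ , split₁ | a₂ , b₂ , r∼a₂ , r∼b₂ , split₂ =
      representativeAt-injective representatives representatives-apart k₁ k₂
        (r₁∼r₂ (SameBlock-SplitAt p _ a₁ b₁ a₂ b₂ split₁ (subst (SplitAt (leafNode a₂) (leafNode b₂)) (sym same-vertex) split₂)
                  (SameBlock-trans p a₁ r₁ b₁ (SameBlock-sym p r₁ a₁ r∼a₁) r∼b₁)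
                  (SameBlock-trans p a₂ r₂ b₂ (SameBlock-sym p r₂ a₂ r∼a₂) r∼b₂)))
      where
      r₁ = representativeAt representatives k₁
      r₂ = representativeAt representatives k₂
      r₁∼r₂ : SameBlock p a₁ a₂ ⊎ SameBlock p a₁ b₂ → SameBlock p r₁ r₂
      r₁∼r₂ (inj₁ q) = SameBlock-trans p r₁ a₁ r₂ r∼a₁ (SameBlock-trans p a₁ a₂ r₂ q (SameBlock-sym p r₂ a₂ r∼a₂))
      r₁∼r₂ (inj₂ q) = SameBlock-trans p r₁ a₁ r₂ r∼a₁ (SameBlock-trans p a₁ b₂ r₂ q (SameBlock-sym p r₂ b₂ r∼b₂))

    decodedMap-innerInjective : ∀ v w → vlabel decodedForest v ≡ nothing → vlabel decodedForest w ≡ nothing →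
      decodedMap v ≡ decodedMap w → v ≡ w
    decodedMap-innerInjective (k₁ , u₁) (k₂ , u₂) inner₁ inner₂ same-image
      with inner-sameTree k₁ k₂ u₁ u₂ inner₁ inner₂ (cong vertexOfT same-image)
    ... | refl = cong (k₁ ,_) (Spans.injective (spansAt representatives k₁) u₁ u₂ (cong vertexOfT same-image))

    decoded≤T : decodedForest ≤F (T ∷ [])
    decoded≤T = record
      { ψ = decodedMap
      ; onLeaves = λ { (k , u) i h → emb-label (embeddingAt representatives k) u i h }
      ; onInner = λ { (k , u) h → emb-inner (embeddingAt representatives k) u h }
      ; innerInj = decodedMap-innerInjective
      ; onEdges = λ k p → SplitAt⇒Split (emb-split (embeddingAt representatives k) p) }

    decode : IntervalElt T
    decode = decodedForest , (blockForest-unique representatives representatives-apart , decodedForest-covers) , decoded≤T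

    SameTreeᴸ-decode⁻ : ∀ a b → SameTreeᴸ decode a b → SameBlock p a b
    SameTreeᴸ-decode⁻ a b (k , a∈ , b∈)
      with blockForest-label⁻ representatives k (leafLabel a) a∈ | blockForest-label⁻ representatives k (leafLabel b) b∈
    ... | a' , k∼a' , a'↦ | b' , k∼b' , b'↦ with leafLabel-injective a' a a'↦ | leafLabel-injective b' b b'↦
    ...   | refl | refl = SameBlock-trans p a' (representativeAt representatives k) b' (SameBlock-sym p _ a' k∼a') k∼b'

    SameTreeᴸ-decode⁺ : ∀ a b → SameBlock p a b → SameTreeᴸ decode a b
    SameTreeᴸ-decode⁺ a b a∼b with representative-of a
    ... | k , k∼a =
      k , blockForest-label⁺ representatives k a k∼a , blockForest-label⁺ representatives k b (SameBlock-trans p _ a b k∼a a∼b)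

  encodeᴵ : IntervalElt T → Partition T
  encodeᴵ x = encode T (SameTreeᴸ x) (SameTreeᴸ-isDecEquivalence x)

  encodeᴵ-represents : ∀ x → Represents (encodeᴵ x) (SameTreeᴸ x)
  encodeᴵ-represents x = encode-represents T (SameTreeᴸ-isDecEquivalence x) (SameTreeᴸ-compatible x)

  encodeᴵ-mono : ∀ {x y} → x ≤I y → encodeᴵ x ⊑ encodeᴵ y
  encodeᴵ-mono {x} {y} x≤y = mk⊑ λ a b a∼b →
    proj₂ (encodeᴵ-represents y a b) (≤F⇒SameTree⊆ x≤y (leafLabel a) (leafLabel b) (proj₁ (encodeᴵ-represents x a b) a∼b))

  encodeᴵ-reflects : ∀ {x y} → encodeᴵ x ⊑ encodeᴵ y → x ≤I y
  encodeᴵ-reflects {x} {y} x⊑y = SameTree⊆⇒≤F x y sameTree⊆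
    where
    sameTree⊆ : ∀ i j → SameTree (forest x) i j → SameTree (forest y) i j
    sameTree⊆ i j i∼j with leafLabel-surjective i | leafLabel-surjective j
    ... | a , refl | b , refl = proj₁ (encodeᴵ-represents y a b) (⊑-sameBlock x⊑y a b (proj₂ (encodeᴵ-represents x a b) i∼j))

  encode-decode⊑ : ∀ p → encodeᴵ (Decode.decode p) ⊑ p
  encode-decode⊑ p = mk⊑ λ a b a∼b → Decode.SameTreeᴸ-decode⁻ p a b (proj₁ (encodeᴵ-represents (Decode.decode p) a b) a∼b)

  ⊑encode-decode : ∀ p → p ⊑ encodeᴵ (Decode.decode p)
  ⊑encode-decode p = mk⊑ λ a b a∼b → proj₂ (encodeᴵ-represents (Decode.decode p) a b) (Decode.SameTreeᴸ-decode⁺ p a b a∼b)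

  IntervalElt-isLLLattice : IsLLLattice (IntervalElt T) _≤I_
  IntervalElt-isLLLattice = IsLLLattice-transfer (Partition-isLLLattice T)
    where
    open TransferAlongEquivalence _≤I_ _⊑_ (⊑-refl _) ⊑-trans encodeᴵ Decode.decode
      (λ {x} {y} → encodeᴵ-mono {x} {y}) (λ {x} {y} → encodeᴵ-reflects {x} {y}) encode-decode⊑ ⊑encode-decode

mainTheorem12 : (n : ℕ) (T : Tr n) → IsForestOn (T ∷ []) →
    IsLLLattice (IntervalElt T) _≤I_
mainTheorem12 n T (unique , covers) =
  BelowTree.IntervalElt-isLLLattice T (subst Unique (++-identityʳ (leafLabels T)) unique)
    (λ i → subst (i ∈_) (++-identityʳ (leafLabels T)) (covers i))
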